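{- For all $n\geq 1$ and all positive integers $m$, $\Omega_{\varepsilon Z_n}(m)=\Omega_{o\bar Z_n}(m)$, and consequently $A_{\varepsilon Z_n}(t)=A_{o\bar Z_n}(t)$.
   Context: For a poset $P$ on $[n]$, a $P$-partition is a map $f:[n]\to\{1,2,3,\dots\}$ such that whenever $i<_P j$: $f(i)\leq f(j)$ if $i<j$, and $f(i)<f(j)$ if $i>j$. The order polynomial $\Omega_P(m)$ is the number of $P$-partitions with all values in $\{1,\dots,m\}$. A linear extension of $P$ is a permutation $\pi\in S_n$ with $\pi^{ -1}(i)<\pi^{ -1}(j)$ whenever $i<_P j$; $\mathcal{L}(P)$ is the set of these. The $P$-Eulerian polynomial is $A_P(t)=\sum_{\pi\in\mathcal{L}(P)}t^{1+\mathrm{des}(\pi)}$, where $\mathrm{des}(\pi)=|\{i\in[n-1]:\pi(i)>\pi(i+1)\}|$. The zig-zag poset $Z_n$ on $[n]$ is generated by $j<j+1$ for odd $j$ and $j>j+1$ for even $j$ ($j\in[n-1]$); the down-up zig-zag poset $\bar Z_n$ is generated by $j>j+1$ for odd $j$ and $j<j+1$ for even $j$. For a permutation $\sigma\in S_n$ and a poset $Q$ on $[n]$, $\sigma Q$ is the poset on $[n]$ with $\sigma(i)<_{\sigma Q}\sigma(j)$ iff $i<_Q j$. Here $\varepsilon\in S_n$ is the involution swapping $2i$ and $2i+1$ for every $i\ge1$ with $2i+1\leq n$ (fixing other elements), and $o\in S_n$ is the involution swapping $2i-1$ and $2i$ for every $i\geq1$ with $2i\leq n$. -}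

module Defs where

open import Data.Bool using (Bool; true; false; _∧_; _∨_; not; if_then_else_)
open import Data.Nat using (ℕ; zero; suc; _+_; _∸_; _≡ᵇ_; _<ᵇ_; _≤ᵇ_; _%_)
open import Data.List using (List; []; _∷_; map; concatMap; filter; length; upTo)
open import Data.Bool.ListAction using (any; all)
open import Relation.Binary.PropositionalEquality using (_≡_)
open import Relation.Nullary.Decidable using (Dec)
open import Data.Bool.Properties using (T?)
open import Data.Bool using (T)

range : ℕ → List ℕ
range n = map suc (upTo n)

-- A (strict) relation on [n], given by a Boolean predicate
-- (only its values on [n] × [n] matter).
Rel : Set
Rel = ℕ → ℕ → Bool

isOdd isEven : ℕ → Bool
isOdd k = k % 2 ≡ᵇ 1
isEven k = k % 2 ≡ᵇ 0

-- Transitive closure on [n] of a generating relation g: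
-- iter k gives "reachable by a g-path with at most k+1 steps inside [n]".
-- Since [n] has n elements, k = n already yields the full transitive closure.
closureStep : ℕ → Rel → Rel → Rel
closureStep n g R a b = R a b ∨ any (λ c → R a c ∧ g c b) (range n)

iter : ℕ → ℕ → Rel → Rel → Rel
iter n zero    g R = R
iter n (suc k) g R = iter n k g (closureStep n g R)

generated : ℕ → Rel → Rel
generated n g = iter n n g g

inRange : ℕ → ℕ → Bool
inRange n a = (1 ≤ᵇ a) ∧ (a ≤ᵇ n)

zigGen : ℕ → Rel
zigGen n a b =
  inRange n a ∧ inRange n b ∧
  (((b ≡ᵇ suc a) ∧ isOdd a) ∨ ((a ≡ᵇ suc b) ∧ isEven b))

Z : ℕ → Rel
Z n = generated n (zigGen n)

zigBarGen : ℕ → Rel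
zigBarGen n a b =
  inRange n a ∧ inRange n b ∧
  (((a ≡ᵇ suc b) ∧ isOdd b) ∨ ((b ≡ᵇ suc a) ∧ isEven a))

Zbar : ℕ → Rel
Zbar n = generated n (zigBarGen n)

act : ℕ → (ℕ → ℕ) → Rel → Rel
act n σ Q a b =
  any (λ i → any (λ j → (σ i ≡ᵇ a) ∧ (σ j ≡ᵇ b) ∧ Q i j) (range n)) (range n)

ε : ℕ → ℕ → ℕ
ε n k =
  if isEven k ∧ (2 ≤ᵇ k) ∧ (suc k ≤ᵇ n) then suc k
  else if isOdd k ∧ (3 ≤ᵇ k) ∧ (k ≤ᵇ n) then k ∸ 1
  else k

o : ℕ → ℕ → ℕ
o n k =
  if isOdd k ∧ (suc k ≤ᵇ n) then suc k
  else if isEven k ∧ (2 ≤ᵇ k) ∧ (k ≤ᵇ n) then k ∸ 1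
  else k

-- Maps [n] → ℕ represented as lists: f(i) is the i-th entry (1-based).
nth : List ℕ → ℕ → ℕ
nth []       _             = 0
nth (x ∷ xs) zero          = 0
nth (x ∷ xs) (suc zero)    = x
nth (x ∷ xs) (suc (suc i)) = nth xs (suc i)

maps : ℕ → ℕ → List (List ℕ)
maps zero    m = [] ∷ []
maps (suc n) m = concatMap (λ x → map (x ∷_) (maps n m)) (range m)

isPPartition : ℕ → Rel → List ℕ → Bool
isPPartition n P f =
  all (λ i → all (λ j →
        not (P i j) ∨
        (if i <ᵇ j then nth f i ≤ᵇ nth f j else nth f i <ᵇ nth f j))
      (range n)) (range n)

Ω : ℕ → Rel → ℕ → ℕ
Ω n P m = length (filter (λ f → T? (isPPartition n P f)) (maps n m))

-- permutations of a list (π given in one-line notation π(1) … π(n))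
insertions : ℕ → List ℕ → List (List ℕ)
insertions x []       = (x ∷ []) ∷ []
insertions x (y ∷ ys) = (x ∷ y ∷ ys) ∷ map (y ∷_) (insertions x ys)

perms : List ℕ → List (List ℕ)
perms []       = [] ∷ []
perms (x ∷ xs) = concatMap (insertions x) (perms xs)

-- π^{-1}(i): position (1-based) of i in π
posOf : List ℕ → ℕ → ℕ
posOf []       i = 0
posOf (x ∷ xs) i = if x ≡ᵇ i then 1 else suc (posOf xs i)

isLinExt : ℕ → Rel → List ℕ → Bool
isLinExt n P π =
  all (λ i → all (λ j → not (P i j) ∨ (posOf π i <ᵇ posOf π j)) (range n)) (range n)

des : List ℕ → ℕ
des []           = 0
des (x ∷ [])     = 0
des (x ∷ y ∷ ys) = (if y <ᵇ x then 1 else 0) + des (y ∷ ys)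

-- coefficient of t^k in A_P(t) = Σ_{π ∈ L(P)} t^{1 + des π}
AP-coeff : ℕ → Rel → ℕ → ℕ
AP-coeff n P k =
  length (filter (λ π → T? (isLinExt n P π ∧ (suc (des π) ≡ᵇ k))) (perms (range n)))

-- Two operations on a labelled poset P on [n] preserve both Ω_P and A_P: exchanging two labels
-- a, a + 1 that are incomparable in P, and passing to the dual poset with complemented labels
-- x ↦ n + 1 − x. For odd n, oZ̄_n is exactly this dual of εZ_n. For even n, both posets are Z_n
-- relabelled by a word in one-line notation (ε, resp. the complement of o), and the first word is
-- turned into the second by repeatedly exchanging neighbouring entries that are not consecutive
-- numbers, i.e. labels that are incomparable in the relabelled Z_n.

module Submission where

open import Defs
open import Data.Bool using (Bool; true; false; T; _∧_; _∨_; not; if_then_else_)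
open import Data.Bool.Properties using (T?; T-≡; T-∧; T-∨; ∨-comm; ∧-comm; ∨-identityʳ; not-involutive)
open import Data.Bool.ListAction using (any; all)
open import Data.Empty using (⊥; ⊥-elim)
open import Data.List using (List; []; _∷_; [_]; map; filter; length; upTo; concatMap; _++_; reverse; _∷ʳ_)
open import Data.List.Properties
  using (map-∘; map-++; map-cong; ++-assoc; ++-identityʳ; unfold-reverse; length-map; length-++;
         length-reverse; length-upTo; concatMap-cong; concatMap-map; map-concatMap; concatMap-++)
open import Data.List.Membership.Propositional using (_∈_; _∉_; find; lose)
open import Data.List.Membership.Propositional.Properties using (∈-map⁻; ∈-map⁺; ∈-upTo⁺; ∈-upTo⁻; ∈-concat⁻′; ∈-++⁻)
open import Data.List.Relation.Unary.Any using (here; there)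
open import Data.List.Relation.Unary.Any.Properties using (any⁺; any⁻)
open import Data.List.Relation.Unary.All as All using (All)
open import Data.List.Relation.Unary.All.Properties using (all⁺; all⁻) renaming (map⁺ to All-map⁺)
open import Data.List.Relation.Unary.AllPairs as AllPairs using (_∷_)
open import Data.List.Relation.Unary.Unique.Propositional using (Unique)
open import Data.List.Relation.Unary.Unique.Propositional.Properties as Unique using (Unique[x∷xs]⇒x∉xs)
open import Data.List.Relation.Binary.Permutation.Propositional hiding (trans)
open import Data.List.Relation.Binary.Permutation.Propositional.Properties
  using (↭-reverse; map⁺; ∈-resp-↭; ↭-length; filter-↭; shifts; ∷↭∷ʳ; ++⁺; ++⁺ˡ; ++⁺ʳ)
import Data.List.Relation.Binary.Permutation.Setoid.Properties as Permutationₛ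
open import Data.List.Relation.Binary.BagAndSetEquality using (∼bag⇒↭)
open import Data.List.Membership.Propositional.Properties.WithK using (unique∧set⇒bag)
open import Function.Bundles using (Equivalence; mk⇔)
open import Data.Nat
open import Data.Nat.Properties
open import Data.Nat.DivMod using ([m+n]%n≡m%n)
open import Data.Product using (∃; _×_; _,_; proj₁; proj₂) renaming (map to ×-map)
open import Data.Sum using (_⊎_; inj₁; inj₂; [_,_]′) renaming (map to ⊎-map; swap to ⊎-swap)
open import Data.Unit using (⊤; tt)
open import Function using (_∘_)
open import Relation.Binary.Construct.Closure.ReflexiveTransitive using (Star; _◅_; _◅◅_; gmap) renaming (ε to ◅-refl)
open import Relation.Binary.PropositionalEquality hiding ([_])
open import Relation.Nullary using (¬_; Dec; yes; no)

private
  variable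
    A B C : Set

T-ext : ∀ {a b} → (T a → T b) → (T b → T a) → a ≡ b
T-ext {false} {false} _ _ = refl
T-ext {false} {true}  _ g = ⊥-elim (g tt)
T-ext {true}  {false} f _ = ⊥-elim (f tt)
T-ext {true}  {true}  _ _ = refl

T-∧ˡ : ∀ {a b} → T (a ∧ b) → T a
T-∧ˡ {a} = proj₁ ∘ Equivalence.to (T-∧ {a})

T-∧ʳ : ∀ {a b} → T (a ∧ b) → T b
T-∧ʳ {a} = proj₂ ∘ Equivalence.to (T-∧ {a})

T-∧⁺ : ∀ {a b} → T a → T b → T (a ∧ b)
T-∧⁺ {a} ta tb = Equivalence.from (T-∧ {a}) (ta , tb)

T-∨⁻ : ∀ {a b} → T (a ∨ b) → T a ⊎ T b
T-∨⁻ {a} = Equivalence.to (T-∨ {a})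

T-∨ˡ : ∀ {a b} → T a → T (a ∨ b)
T-∨ˡ {a} = Equivalence.from (T-∨ {a}) ∘ inj₁

T-∨ʳ : ∀ {a b} → T b → T (a ∨ b)
T-∨ʳ {a} = Equivalence.from (T-∨ {a}) ∘ inj₂

T⇒≡true : ∀ {a} → T a → a ≡ true
T⇒≡true = Equivalence.to T-≡

¬T⇒≡false : ∀ {a} → ¬ T a → a ≡ false
¬T⇒≡false {false} _ = refl
¬T⇒≡false {true}  h = ⊥-elim (h tt)

≡true⇒T : ∀ {a} → a ≡ true → T a
≡true⇒T = Equivalence.from T-≡

≡false⇒¬T : ∀ {a} → a ≡ false → ¬ T a
≡false⇒¬T refl ()

true≢false : ∀ {b : Bool} → b ≡ true → b ≡ false → ⊥
true≢false refl ()

≡ᵇ-refl : ∀ x → (x ≡ᵇ x) ≡ true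
≡ᵇ-refl x = T⇒≡true (≡⇒≡ᵇ x x refl)

≢⇒≡ᵇ-false : ∀ x y → x ≢ y → (x ≡ᵇ y) ≡ false
≢⇒≡ᵇ-false x y h = ¬T⇒≡false (h ∘ ≡ᵇ⇒≡ x y)

≤⇒≤ᵇ-true : ∀ {m n} → m ≤ n → (m ≤ᵇ n) ≡ true
≤⇒≤ᵇ-true = T⇒≡true ∘ ≤⇒≤ᵇ

≰⇒≤ᵇ-false : ∀ {m n} → ¬ m ≤ n → (m ≤ᵇ n) ≡ false
≰⇒≤ᵇ-false {m} {n} h = ¬T⇒≡false (h ∘ ≤ᵇ⇒≤ m n)

InRange : ℕ → ℕ → Set
InRange n i = 1 ≤ i × i ≤ n

∈-range⁻ : ∀ {n i} → i ∈ range n → InRange n i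
∈-range⁻ m with ∈-map⁻ suc m
... | _ , j∈ , refl = s≤s z≤n , ∈-upTo⁻ j∈

∈-range⁺ : ∀ {n i} → InRange n i → i ∈ range n
∈-range⁺ {i = suc j} (_ , j<n) = ∈-map⁺ suc (∈-upTo⁺ j<n)

inRange-true : ∀ n i → InRange n i → inRange n i ≡ true
inRange-true n i (1≤i , i≤n) rewrite ≤⇒≤ᵇ-true 1≤i | ≤⇒≤ᵇ-true i≤n = refl

all-range⁻ : ∀ (p : ℕ → Bool) n → T (all p (range n)) → ∀ i → InRange n i → T (p i)
all-range⁻ p n h i r = All.lookup (all⁺ p (range n) h) (∈-range⁺ r)

all-range⁺ : ∀ (p : ℕ → Bool) n → (∀ i → InRange n i → T (p i)) → T (all p (range n))
all-range⁺ p n h = all⁻ p (All.tabulate (λ m → h _ (∈-range⁻ m)))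

any-range⁻ : ∀ (p : ℕ → Bool) n → T (any p (range n)) → ∃ λ i → InRange n i × T (p i)
any-range⁻ p n h with find (any⁻ p (range n) h)
... | i , i∈ , pi = i , ∈-range⁻ i∈ , pi

any-range⁺ : ∀ (p : ℕ → Bool) n i → InRange n i → T (p i) → T (any p (range n))
any-range⁺ p n i r pi = any⁺ p (lose (∈-range⁺ r) pi)

all-range-cong : ∀ (p q : ℕ → Bool) n → (∀ i → InRange n i → p i ≡ q i) →
  all p (range n) ≡ all q (range n)
all-range-cong p q n h = T-ext
  (λ t → all-range⁺ q n (λ i r → subst T (h i r) (all-range⁻ p n t i r)))
  (λ t → all-range⁺ p n (λ i r → subst T (sym (h i r)) (all-range⁻ q n t i r)))

all-range-reindex : ∀ (p : ℕ → Bool) n (s : ℕ → ℕ) →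
  (∀ i → InRange n i → InRange n (s i)) → (∀ i → InRange n i → s (s i) ≡ i) →
  all p (range n) ≡ all (p ∘ s) (range n)
all-range-reindex p n s s-range s-inv = T-ext
  (λ t → all-range⁺ _ n (λ i r → all-range⁻ p n t (s i) (s-range i r)))
  (λ t → all-range⁺ p n (λ i r → subst (T ∘ p) (s-inv i r) (all-range⁻ _ n t (s i) (s-range i r))))

any-range-false : ∀ (p : ℕ → Bool) n → (∀ i → p i ≡ false) → any p (range n) ≡ false
any-range-false p n h = ¬T⇒≡false λ t →
  let (i , _ , pi) = any-range⁻ p n t in ≡false⇒¬T (h i) pi

all² : (ℕ → ℕ → Bool) → ℕ → Bool
all² F n = all (λ i → all (F i) (range n)) (range n)

all²-cong : ∀ F G n → (∀ i j → InRange n i → InRange n j → F i j ≡ G i j) → all² F n ≡ all² G n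
all²-cong F G n h = all-range-cong _ _ n (λ i ri → all-range-cong _ _ n (λ j rj → h i j ri rj))

all²-reindex : ∀ F n (s : ℕ → ℕ) →
  (∀ i → InRange n i → InRange n (s i)) → (∀ i → InRange n i → s (s i) ≡ i) →
  all² F n ≡ all² (λ i j → F (s i) (s j)) n
all²-reindex F n s s-range s-inv =
  trans (all-range-cong _ _ n (λ i _ → all-range-reindex (F i) n s s-range s-inv))
        (all-range-reindex (λ i → all (F i ∘ s) (range n)) n s s-range s-inv)

all²-transpose : ∀ F n → all² F n ≡ all² (λ i j → F j i) n
all²-transpose F n = T-ext swapped swapped
  where
    swapped : ∀ {G} → T (all² G n) → T (all² (λ i j → G j i) n)
    swapped t = all-range⁺ _ n (λ i ri → all-range⁺ _ n (λ j rj →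
      all-range⁻ _ n (all-range⁻ _ n t j rj) i ri))

count : (A → Bool) → List A → ℕ
count b xs = length (filter (T? ∘ b) xs)

count-↭ : ∀ (b : A → Bool) {xs ys} → xs ↭ ys → count b xs ≡ count b ys
count-↭ b p = ↭-length (filter-↭ (T? ∘ b) p)

count-map : ∀ (b : B → Bool) (g : A → B) xs → count b (map g xs) ≡ count (b ∘ g) xs
count-map b g [] = refl
count-map b g (x ∷ xs) with b (g x)
... | true  = cong suc (count-map b g xs)
... | false = count-map b g xs

count-cong : ∀ (b b′ : A → Bool) xs → (∀ {x} → x ∈ xs → b x ≡ b′ x) → count b xs ≡ count b′ xs
count-cong b b′ [] h = refl
count-cong b b′ (x ∷ xs) h with b x | b′ x | h (here refl)
... | true  | true  | _ = cong suc (count-cong b b′ xs (h ∘ there))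
... | false | false | _ = count-cong b b′ xs (h ∘ there)

count-split : ∀ (b q : A → Bool) xs →
  count b xs ≡ count (λ x → q x ∧ b x) xs + count (λ x → not (q x) ∧ b x) xs
count-split b q [] = refl
count-split b q (x ∷ xs) with q x | b x
... | true  | true  = cong suc (count-split b q xs)
... | true  | false = count-split b q xs
... | false | true  = trans (cong suc (count-split b q xs)) (sym (+-suc _ _))
... | false | false = count-split b q xs

concatMap-concatMap : (f : B → List C) (g : A → List B) (L : List A) →
  concatMap f (concatMap g L) ≡ concatMap (concatMap f ∘ g) L
concatMap-concatMap f g []      = refl
concatMap-concatMap f g (x ∷ L) =
  trans (concatMap-++ f (g x) _) (cong (concatMap f (g x) ++_) (concatMap-concatMap f g L))

concatMap-cong-↭ : (f g : A → List B) (L : List A) → (∀ x → f x ↭ g x) → concatMap f L ↭ concatMap g L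
concatMap-cong-↭ f g []      h = ↭-refl
concatMap-cong-↭ f g (x ∷ L) h = ++⁺ (h x) (concatMap-cong-↭ f g L h)

concatMap-resp-↭ : (f : A → List B) {L L′ : List A} → L ↭ L′ → concatMap f L ↭ concatMap f L′
concatMap-resp-↭ f refl           = ↭-refl
concatMap-resp-↭ f (prep x p)     = ++⁺ˡ (f x) (concatMap-resp-↭ f p)
concatMap-resp-↭ f (swap x y p)   = ↭-trans (shifts (f x) (f y)) (++⁺ˡ (f y) (++⁺ˡ (f x) (concatMap-resp-↭ f p)))
concatMap-resp-↭ f (_↭_.trans p q) = ↭-trans (concatMap-resp-↭ f p) (concatMap-resp-↭ f q)

concatMap-++-distrib : (f g : A → List B) (L : List A) →
  concatMap (λ y → f y ++ g y) L ↭ concatMap f L ++ concatMap g L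
concatMap-++-distrib f g []      = ↭-refl
concatMap-++-distrib f g (x ∷ L) = begin
    (f x ++ g x) ++ concatMap (λ y → f y ++ g y) L   ≡⟨ ++-assoc (f x) (g x) _ ⟩
    f x ++ g x ++ concatMap (λ y → f y ++ g y) L     ↭⟨ ++⁺ˡ (f x) (++⁺ˡ (g x) (concatMap-++-distrib f g L)) ⟩
    f x ++ g x ++ concatMap f L ++ concatMap g L     ↭⟨ ++⁺ˡ (f x) (shifts (g x) (concatMap f L)) ⟩
    f x ++ concatMap f L ++ g x ++ concatMap g L     ≡⟨ ++-assoc (f x) _ _ ⟨
    (f x ++ concatMap f L) ++ g x ++ concatMap g L   ∎
  where open PermutationReasoning

concatMap-[] : (L : List A) → concatMap {B = C} (λ _ → []) L ≡ []
concatMap-[] []      = refl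
concatMap-[] (x ∷ L) = concatMap-[] L

concatMap-comm : (h : A → B → List C) (As : List A) (Bs : List B) →
  concatMap (λ x → concatMap (h x) Bs) As ↭ concatMap (λ y → concatMap (λ x → h x y) As) Bs
concatMap-comm h []       Bs = ↭-reflexive (sym (concatMap-[] Bs))
concatMap-comm h (a ∷ As) Bs = ↭-trans (++⁺ˡ (concatMap (h a) Bs) (concatMap-comm h As Bs))
  (↭-sym (concatMap-++-distrib (h a) (λ y → concatMap (λ x → h x y) As) Bs))

map-insertions : (f : ℕ → ℕ) (x : ℕ) (l : List ℕ) →
  map (map f) (insertions x l) ≡ insertions (f x) (map f l)
map-insertions f x []      = refl
map-insertions f x (y ∷ l) = cong ((f x ∷ f y ∷ map f l) ∷_) (begin
    map (map f) (map (y ∷_) (insertions x l))   ≡⟨ map-∘ (insertions x l) ⟨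
    map (map f ∘ (y ∷_)) (insertions x l)       ≡⟨ map-∘ (insertions x l) ⟩
    map (f y ∷_) (map (map f) (insertions x l)) ≡⟨ cong (map (f y ∷_)) (map-insertions f x l) ⟩
    map (f y ∷_) (insertions (f x) (map f l))   ∎)
  where open ≡-Reasoning

map-perms : (f : ℕ → ℕ) (xs : List ℕ) → map (map f) (perms xs) ≡ perms (map f xs)
map-perms f []       = refl
map-perms f (x ∷ xs) = begin
    map (map f) (concatMap (insertions x) (perms xs))      ≡⟨ map-concatMap (map f) (insertions x) (perms xs) ⟩
    concatMap (map (map f) ∘ insertions x) (perms xs)      ≡⟨ concatMap-cong (map-insertions f x) (perms xs) ⟩
    concatMap (insertions (f x) ∘ map f) (perms xs)        ≡⟨ concatMap-map (insertions (f x)) (map f) (perms xs) ⟨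
    concatMap (insertions (f x)) (map (map f) (perms xs))  ≡⟨ cong (concatMap (insertions (f x))) (map-perms f xs) ⟩
    concatMap (insertions (f x)) (perms (map f xs))        ∎
  where open ≡-Reasoning

insertions-comm : (x y : ℕ) (l : List ℕ) →
  concatMap (insertions x) (insertions y l) ↭ concatMap (insertions y) (insertions x l)
insertions-comm x y []       = swap _ _ refl
insertions-comm x y (z ∷ zs) = begin
    concatMap (insertions x) (insertions y (z ∷ zs))
      ≡⟨ cong (λ u → xyz ∷ yxz ∷ map (y ∷_) (map (z ∷_) (insertions x zs)) ++ u)
              (concatMap-map (insertions x) (z ∷_) (insertions y zs)) ⟩
    xyz ∷ yxz ∷ map (y ∷_) (map (z ∷_) (insertions x zs)) ++ concatMap (λ w → (x ∷ z ∷ w) ∷ map (z ∷_) (insertions x w)) (insertions y zs)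
      ↭⟨ swap _ _ (++⁺ˡ (map (y ∷_) (map (z ∷_) (insertions x zs))) (split x (insertions y zs))) ⟩
    yxz ∷ xyz ∷ map (y ∷_) (map (z ∷_) (insertions x zs)) ++ map (λ w → x ∷ z ∷ w) (insertions y zs) ++ map (z ∷_) (concatMap (insertions x) (insertions y zs))
      ↭⟨ prep _ (prep _ (shifts (map (y ∷_) (map (z ∷_) (insertions x zs))) (map (λ w → x ∷ z ∷ w) (insertions y zs)))) ⟩
    yxz ∷ xyz ∷ map (λ w → x ∷ z ∷ w) (insertions y zs) ++ map (y ∷_) (map (z ∷_) (insertions x zs)) ++ map (z ∷_) (concatMap (insertions x) (insertions y zs))
      ↭⟨ prep _ (prep _ (++⁺ˡ (map (λ w → x ∷ z ∷ w) (insertions y zs))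
           (++⁺ (↭-reflexive (sym (map-∘ (insertions x zs)))) (map⁺ (z ∷_) (insertions-comm x y zs))))) ⟩
    yxz ∷ xyz ∷ map (λ w → x ∷ z ∷ w) (insertions y zs) ++ map (λ w → y ∷ z ∷ w) (insertions x zs) ++ map (z ∷_) (concatMap (insertions y) (insertions x zs))
      ↭⟨ prep _ (prep _ (++⁺ʳ _ (↭-reflexive (map-∘ (insertions y zs))))) ⟩
    yxz ∷ xyz ∷ map (x ∷_) (map (z ∷_) (insertions y zs)) ++ map (λ w → y ∷ z ∷ w) (insertions x zs) ++ map (z ∷_) (concatMap (insertions y) (insertions x zs))
      ↭⟨ prep _ (prep _ (++⁺ˡ (map (x ∷_) (map (z ∷_) (insertions y zs))) (↭-sym (split y (insertions x zs))))) ⟩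
    yxz ∷ xyz ∷ map (x ∷_) (map (z ∷_) (insertions y zs)) ++ concatMap (λ w → (y ∷ z ∷ w) ∷ map (z ∷_) (insertions y w)) (insertions x zs)
      ≡⟨ cong (λ u → yxz ∷ xyz ∷ map (x ∷_) (map (z ∷_) (insertions y zs)) ++ u)
              (sym (concatMap-map (insertions y) (z ∷_) (insertions x zs))) ⟩
    concatMap (insertions y) (insertions x (z ∷ zs)) ∎
  where
    open PermutationReasoning
    xyz yxz : List ℕ
    xyz = x ∷ y ∷ z ∷ zs
    yxz = y ∷ x ∷ z ∷ zs
    singletons : (a : ℕ) (W : List (List ℕ)) → concatMap (λ w → [ a ∷ z ∷ w ]) W ≡ map (λ w → a ∷ z ∷ w) W
    singletons a []      = refl
    singletons a (w ∷ W) = cong (_ ∷_) (singletons a W)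
    split : (a : ℕ) (W : List (List ℕ)) →
      concatMap (λ w → (a ∷ z ∷ w) ∷ map (z ∷_) (insertions a w)) W ↭
      map (λ w → a ∷ z ∷ w) W ++ map (z ∷_) (concatMap (insertions a) W)
    split a W = ↭-trans (concatMap-++-distrib (λ w → [ a ∷ z ∷ w ]) (λ w → map (z ∷_) (insertions a w)) W)
      (++⁺ (↭-reflexive (singletons a W)) (↭-reflexive (sym (map-concatMap (z ∷_) (insertions a) W))))

perms-resp-↭ : {xs ys : List ℕ} → xs ↭ ys → perms xs ↭ perms ys
perms-resp-↭ refl       = ↭-refl
perms-resp-↭ (prep x p) = concatMap-resp-↭ (insertions x) (perms-resp-↭ p)
perms-resp-↭ {x ∷ y ∷ xs} {y ∷ x ∷ ys} (swap x y p) = begin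
    concatMap (insertions x) (concatMap (insertions y) (perms xs))
      ≡⟨ concatMap-concatMap (insertions x) (insertions y) (perms xs) ⟩
    concatMap (concatMap (insertions x) ∘ insertions y) (perms xs)
      ↭⟨ concatMap-cong-↭ _ _ (perms xs) (insertions-comm x y) ⟩
    concatMap (concatMap (insertions y) ∘ insertions x) (perms xs)
      ↭⟨ concatMap-resp-↭ _ (perms-resp-↭ p) ⟩
    concatMap (concatMap (insertions y) ∘ insertions x) (perms ys)
      ≡⟨ concatMap-concatMap (insertions y) (insertions x) (perms ys) ⟨
    concatMap (insertions y) (concatMap (insertions x) (perms ys)) ∎
  where open PermutationReasoning
perms-resp-↭ (_↭_.trans p q) = ↭-trans (perms-resp-↭ p) (perms-resp-↭ q)

insertions-∷ʳ : (x z : ℕ) (l : List ℕ) →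
  insertions x (l ∷ʳ z) ≡ map (_∷ʳ z) (insertions x l) ++ [ (l ∷ʳ z) ∷ʳ x ]
insertions-∷ʳ x z []      = refl
insertions-∷ʳ x z (y ∷ l) = cong ((x ∷ y ∷ l ∷ʳ z) ∷_) (begin
    map (y ∷_) (insertions x (l ∷ʳ z))
      ≡⟨ cong (map (y ∷_)) (insertions-∷ʳ x z l) ⟩
    map (y ∷_) (map (_∷ʳ z) (insertions x l) ++ [ (l ∷ʳ z) ∷ʳ x ])
      ≡⟨ map-++ (y ∷_) (map (_∷ʳ z) (insertions x l)) _ ⟩
    map (y ∷_) (map (_∷ʳ z) (insertions x l)) ++ [ y ∷ (l ∷ʳ z) ∷ʳ x ]
      ≡⟨ cong (_++ [ y ∷ (l ∷ʳ z) ∷ʳ x ]) (trans (sym (map-∘ (insertions x l))) (map-∘ (insertions x l))) ⟩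
    map (_∷ʳ z) (map (y ∷_) (insertions x l)) ++ [ y ∷ (l ∷ʳ z) ∷ʳ x ] ∎)
  where open ≡-Reasoning

map-reverse-insertions : (x : ℕ) (l : List ℕ) → map reverse (insertions x l) ↭ insertions x (reverse l)
map-reverse-insertions x []       = ↭-refl
map-reverse-insertions x (y ∷ ys) = begin
    reverse (x ∷ y ∷ ys) ∷ map reverse (map (y ∷_) (insertions x ys))
      ≡⟨ cong₂ _∷_ (trans (unfold-reverse x (y ∷ ys)) (cong (_∷ʳ x) (unfold-reverse y ys)))
                   (trans (sym (map-∘ (insertions x ys)))
                          (trans (map-cong (unfold-reverse y) (insertions x ys)) (map-∘ (insertions x ys)))) ⟩
    ((reverse ys ∷ʳ y) ∷ʳ x) ∷ map (_∷ʳ y) (map reverse (insertions x ys))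
      ↭⟨ prep _ (map⁺ (_∷ʳ y) (map-reverse-insertions x ys)) ⟩
    ((reverse ys ∷ʳ y) ∷ʳ x) ∷ map (_∷ʳ y) (insertions x (reverse ys))
      ↭⟨ ∷↭∷ʳ _ _ ⟩
    map (_∷ʳ y) (insertions x (reverse ys)) ++ [ (reverse ys ∷ʳ y) ∷ʳ x ]
      ≡⟨ insertions-∷ʳ x y (reverse ys) ⟨
    insertions x (reverse ys ∷ʳ y)
      ≡⟨ cong (insertions x) (unfold-reverse y ys) ⟨
    insertions x (reverse (y ∷ ys)) ∎
  where open PermutationReasoning

map-reverse-perms : (xs : List ℕ) → map reverse (perms xs) ↭ perms xs
map-reverse-perms []       = ↭-refl
map-reverse-perms (x ∷ xs) = begin
    map reverse (concatMap (insertions x) (perms xs))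
      ≡⟨ map-concatMap reverse (insertions x) (perms xs) ⟩
    concatMap (map reverse ∘ insertions x) (perms xs)
      ↭⟨ concatMap-cong-↭ _ _ (perms xs) (map-reverse-insertions x) ⟩
    concatMap (insertions x ∘ reverse) (perms xs)
      ≡⟨ concatMap-map (insertions x) reverse (perms xs) ⟨
    concatMap (insertions x) (map reverse (perms xs))
      ↭⟨ concatMap-resp-↭ (insertions x) (map-reverse-perms xs) ⟩
    concatMap (insertions x) (perms xs) ∎
  where open PermutationReasoning

∈-insertions⁻ : ∀ {x l l′} → l′ ∈ insertions x l → l′ ↭ x ∷ l
∈-insertions⁻ {l = []}    (here refl) = ↭-refl
∈-insertions⁻ {l = y ∷ l} (here refl) = ↭-refl
∈-insertions⁻ {x} {y ∷ l} (there m) with ∈-map⁻ (y ∷_) m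
... | _ , m′ , refl = ↭-trans (prep y (∈-insertions⁻ m′)) (swap y x ↭-refl)

∈-perms⁻ : ∀ {xs π} → π ∈ perms xs → π ↭ xs
∈-perms⁻ {[]} (here refl) = ↭-refl
∈-perms⁻ {x ∷ xs} m with ∈-concat⁻′ (map (insertions x) (perms xs)) m
... | _ , π∈ , L∈ with ∈-map⁻ (insertions x) L∈
... | l , l∈ , refl = ↭-trans (∈-insertions⁻ π∈) (prep x (∈-perms⁻ l∈))

words : ℕ → List A → List (List A)
words zero    L = [] ∷ []
words (suc n) L = concatMap (λ x → map (x ∷_) (words n L)) L

maps≡words : ∀ n m → maps n m ≡ words n (range m)
maps≡words zero    m = refl
maps≡words (suc n) m = cong (λ W → concatMap (λ x → map (x ∷_) W) (range m)) (maps≡words n m)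

map-words : ∀ (f : A → B) n L → map (map f) (words n L) ≡ words n (map f L)
map-words f zero    L = refl
map-words f (suc n) L = begin
    map (map f) (concatMap (λ x → map (x ∷_) (words n L)) L)
      ≡⟨ map-concatMap (map f) _ L ⟩
    concatMap (λ x → map (map f) (map (x ∷_) (words n L))) L
      ≡⟨ concatMap-cong (λ x → trans (sym (map-∘ (words n L))) (map-∘ (words n L))) L ⟩
    concatMap (λ x → map (f x ∷_) (map (map f) (words n L))) L
      ≡⟨ concatMap-cong (λ x → cong (map (f x ∷_)) (map-words f n L)) L ⟩
    concatMap (λ x → map (f x ∷_) (words n (map f L))) L
      ≡⟨ concatMap-map (λ y → map (y ∷_) (words n (map f L))) f L ⟨
    words (suc n) (map f L) ∎
  where open ≡-Reasoning

words-resp-↭ : ∀ n {L L′ : List A} → L ↭ L′ → words n L ↭ words n L′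
words-resp-↭ zero    p = ↭-refl
words-resp-↭ (suc n) {L} p =
  ↭-trans (concatMap-cong-↭ _ _ L (λ x → map⁺ (x ∷_) (words-resp-↭ n p))) (concatMap-resp-↭ _ p)

words-suc-suc : ∀ n (L : List A) →
  words (suc (suc n)) L ≡ concatMap (λ x → concatMap (λ y → map (λ l → x ∷ y ∷ l) (words n L)) L) L
words-suc-suc n L = concatMap-cong (λ x → trans (map-concatMap (x ∷_) (λ y → map (y ∷_) (words n L)) L)
  (concatMap-cong (λ y → sym (map-∘ (words n L))) L)) L

-- Positions are 1-based, as in nth.
swapAt : ℕ → List A → List A
swapAt (suc zero)    (x ∷ y ∷ l) = y ∷ x ∷ l
swapAt (suc (suc a)) (x ∷ l)     = x ∷ swapAt (suc a) l
swapAt _             l           = l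

map-swapAt-words : ∀ a n (L : List A) → 1 ≤ a → suc a ≤ n → map (swapAt a) (words n L) ↭ words n L
map-swapAt-words (suc zero) (suc (suc n)) L _ _ = begin
    map (swapAt 1) (words (suc (suc n)) L)
      ≡⟨ cong (map (swapAt 1)) (words-suc-suc n L) ⟩
    map (swapAt 1) (concatMap (λ x → concatMap (λ y → map (λ l → x ∷ y ∷ l) (words n L)) L) L)
      ≡⟨ trans (map-concatMap (swapAt 1) _ L) (concatMap-cong (λ x → trans (map-concatMap (swapAt 1) _ L)
           (concatMap-cong (λ y → sym (map-∘ (words n L))) L)) L) ⟩
    concatMap (λ x → concatMap (λ y → map (λ l → y ∷ x ∷ l) (words n L)) L) L
      ↭⟨ concatMap-comm (λ x y → map (λ l → y ∷ x ∷ l) (words n L)) L L ⟩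
    concatMap (λ y → concatMap (λ x → map (λ l → y ∷ x ∷ l) (words n L)) L) L
      ≡⟨ words-suc-suc n L ⟨
    words (suc (suc n)) L ∎
  where open PermutationReasoning
map-swapAt-words (suc zero) (suc zero) L _ (s≤s ())
map-swapAt-words (suc (suc a)) (suc n) L _ (s≤s a<n) = begin
    map (swapAt (suc (suc a))) (concatMap (λ x → map (x ∷_) (words n L)) L)
      ≡⟨ trans (map-concatMap _ _ L) (concatMap-cong (λ x → trans (sym (map-∘ (words n L))) (map-∘ (words n L))) L) ⟩
    concatMap (λ x → map (x ∷_) (map (swapAt (suc a)) (words n L))) L
      ↭⟨ concatMap-cong-↭ _ _ L (λ x → map⁺ (x ∷_) (map-swapAt-words (suc a) n L (s≤s z≤n) a<n)) ⟩
    concatMap (λ x → map (x ∷_) (words n L)) L ∎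
  where open PermutationReasoning

words-∷ʳ : ∀ n (L : List A) → words (suc n) L ↭ concatMap (λ x → map (_∷ʳ x) (words n L)) L
words-∷ʳ zero    L = ↭-refl
words-∷ʳ (suc n) L = begin
    concatMap (λ y → map (y ∷_) (words (suc n) L)) L
      ↭⟨ concatMap-cong-↭ _ _ L (λ y → map⁺ (y ∷_) (words-∷ʳ n L)) ⟩
    concatMap (λ y → map (y ∷_) (concatMap (λ x → map (_∷ʳ x) (words n L)) L)) L
      ≡⟨ concatMap-cong (λ y → trans (map-concatMap (y ∷_) _ L) (concatMap-cong (λ x → sym (map-∘ (words n L))) L)) L ⟩
    concatMap (λ y → concatMap (λ x → map (λ l → y ∷ (l ∷ʳ x)) (words n L)) L) L
      ↭⟨ concatMap-comm (λ y x → map (λ l → y ∷ (l ∷ʳ x)) (words n L)) L L ⟩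
    concatMap (λ x → concatMap (λ y → map (λ l → y ∷ (l ∷ʳ x)) (words n L)) L) L
      ≡⟨ concatMap-cong (λ x → trans (concatMap-cong (λ y → map-∘ (words n L)) L) (sym (map-concatMap (_∷ʳ x) _ L))) L ⟩
    concatMap (λ x → map (_∷ʳ x) (words (suc n) L)) L ∎
  where open PermutationReasoning

map-reverse-words : ∀ n (L : List A) → map reverse (words n L) ↭ words n L
map-reverse-words zero    L = ↭-refl
map-reverse-words (suc n) L = begin
    map reverse (concatMap (λ x → map (x ∷_) (words n L)) L)
      ≡⟨ trans (map-concatMap reverse _ L) (concatMap-cong (λ x → trans (sym (map-∘ (words n L)))
           (trans (map-cong (unfold-reverse x) (words n L)) (map-∘ (words n L)))) L) ⟩
    concatMap (λ x → map (_∷ʳ x) (map reverse (words n L))) L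
      ↭⟨ concatMap-cong-↭ _ _ L (λ x → map⁺ (_∷ʳ x) (map-reverse-words n L)) ⟩
    concatMap (λ x → map (_∷ʳ x) (words n L)) L
      ↭⟨ words-∷ʳ n L ⟨
    words (suc n) L ∎
  where open PermutationReasoning

∈-words⁻ : ∀ n (L : List A) {w} → w ∈ words n L → length w ≡ n × (∀ {x} → x ∈ w → x ∈ L)
∈-words⁻ zero    L (here refl) = refl , λ ()
∈-words⁻ (suc n) L m with ∈-concat⁻′ (map (λ x → map (x ∷_) (words n L)) L) m
... | _ , w∈ , W∈ with ∈-map⁻ (λ x → map (x ∷_) (words n L)) W∈
... | x , x∈ , refl with ∈-map⁻ (x ∷_) w∈
... | v , v∈ , refl with ∈-words⁻ n L v∈
... | len , letters = cong suc len , λ { (here refl) → x∈ ; (there y∈) → letters y∈ }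

-- The adjacent transposition (a a+1) of labels

adjTranspose : ℕ → ℕ → ℕ
adjTranspose zero                i                   = i
adjTranspose (suc zero)          zero                = zero
adjTranspose (suc zero)          (suc zero)          = 2
adjTranspose (suc zero)          (suc (suc zero))    = 1
adjTranspose (suc zero)          (suc (suc (suc i))) = suc (suc (suc i))
adjTranspose (suc (suc a))       zero                = zero
adjTranspose (suc (suc a))       (suc i)             = suc (adjTranspose (suc a) i)

adjTranspose-involutive : ∀ a i → adjTranspose a (adjTranspose a i) ≡ i
adjTranspose-involutive zero                i                   = refl
adjTranspose-involutive (suc zero)          zero                = refl
adjTranspose-involutive (suc zero)          (suc zero)          = refl
adjTranspose-involutive (suc zero)          (suc (suc zero))    = refl
adjTranspose-involutive (suc zero)          (suc (suc (suc i))) = refl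
adjTranspose-involutive (suc (suc a))       zero                = refl
adjTranspose-involutive (suc (suc a))       (suc i)             = cong suc (adjTranspose-involutive (suc a) i)

adjTranspose-left : ∀ a → 1 ≤ a → adjTranspose a a ≡ suc a
adjTranspose-left (suc zero)    _ = refl
adjTranspose-left (suc (suc a)) _ = cong suc (adjTranspose-left (suc a) (s≤s z≤n))

adjTranspose-right : ∀ a → 1 ≤ a → adjTranspose a (suc a) ≡ a
adjTranspose-right (suc zero)    _ = refl
adjTranspose-right (suc (suc a)) _ = cong suc (adjTranspose-right (suc a) (s≤s z≤n))

adjTranspose-fixes : ∀ a i → i ≢ a → i ≢ suc a → adjTranspose a i ≡ i
adjTranspose-fixes zero                i                   _ _ = refl
adjTranspose-fixes (suc zero)          zero                _ _ = refl
adjTranspose-fixes (suc zero)          (suc zero)          h _ = ⊥-elim (h refl)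
adjTranspose-fixes (suc zero)          (suc (suc zero))    _ h = ⊥-elim (h refl)
adjTranspose-fixes (suc zero)          (suc (suc (suc i))) _ _ = refl
adjTranspose-fixes (suc (suc a))       zero                _ _ = refl
adjTranspose-fixes (suc (suc a))       (suc i)             h₁ h₂ =
  cong suc (adjTranspose-fixes (suc a) i (h₁ ∘ cong suc) (h₂ ∘ cong suc))

adjTranspose-zero : ∀ a → adjTranspose a 0 ≡ 0
adjTranspose-zero zero          = refl
adjTranspose-zero (suc zero)    = refl
adjTranspose-zero (suc (suc a)) = refl

adjTranspose-suc : ∀ a k → ∃ λ t → adjTranspose a (suc k) ≡ suc t
adjTranspose-suc zero          k                 = k , refl
adjTranspose-suc (suc zero)    zero              = 1 , refl
adjTranspose-suc (suc zero)    (suc zero)        = 0 , refl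
adjTranspose-suc (suc zero)    (suc (suc k))     = suc (suc k) , refl
adjTranspose-suc (suc (suc a)) k                 = adjTranspose (suc a) k , refl

adjTranspose-inRange : ∀ n a i → 1 ≤ a → suc a ≤ n → InRange n i → InRange n (adjTranspose a i)
adjTranspose-inRange n a i 1≤a a<n r with i ≟ a | i ≟ suc a
... | yes refl | _        = subst (InRange n) (sym (adjTranspose-left a 1≤a)) (s≤s z≤n , a<n)
... | no _     | yes refl = subst (InRange n) (sym (adjTranspose-right a 1≤a)) (1≤a , ≤-trans (n≤1+n a) a<n)
... | no h₁    | no h₂    = subst (InRange n) (sym (adjTranspose-fixes a i h₁ h₂)) r

≡ᵇ-adjTranspose : ∀ a x i → (adjTranspose a x ≡ᵇ i) ≡ (x ≡ᵇ adjTranspose a i)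
≡ᵇ-adjTranspose a x i = T-ext
  (λ t → ≡⇒≡ᵇ x _ (trans (sym (adjTranspose-involutive a x)) (cong (adjTranspose a) (≡ᵇ⇒≡ _ i t))))
  (λ t → ≡⇒≡ᵇ _ i (trans (cong (adjTranspose a) (≡ᵇ⇒≡ x _ t)) (adjTranspose-involutive a i)))

nth-swapAt : ∀ a f i → 1 ≤ a → suc a ≤ length f → nth (swapAt a f) i ≡ nth f (adjTranspose a i)
nth-swapAt (suc zero)    (x ∷ y ∷ l) zero                _ _ = refl
nth-swapAt (suc zero)    (x ∷ y ∷ l) (suc zero)          _ _ = refl
nth-swapAt (suc zero)    (x ∷ y ∷ l) (suc (suc zero))    _ _ = refl
nth-swapAt (suc zero)    (x ∷ y ∷ l) (suc (suc (suc i))) _ _ = refl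
nth-swapAt (suc zero)    (x ∷ [])    i                   _ (s≤s ())
nth-swapAt (suc (suc a)) (x ∷ l)     zero                _ _ = refl
nth-swapAt (suc (suc a)) (x ∷ l)     (suc zero)          _ _ rewrite adjTranspose-zero (suc a) = refl
nth-swapAt (suc (suc a)) (x ∷ l)     (suc (suc i))       _ (s≤s a<l)
  with adjTranspose-suc (suc a) i | nth-swapAt (suc a) l (suc i) (s≤s z≤n) a<l
... | _ , e | ih rewrite e = ih

suc-<ᵇ : ∀ x z → z ≢ suc x → (suc x <ᵇ z) ≡ (x <ᵇ z)
suc-<ᵇ x z h = T-ext (λ t → <⇒<ᵇ (<-trans (n<1+n x) (<ᵇ⇒< (suc x) z t)))
  (λ t → <⇒<ᵇ (≤∧≢⇒< (<ᵇ⇒< x z t) (h ∘ sym)))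

<ᵇ-suc : ∀ x z → z ≢ x → (z <ᵇ suc x) ≡ (z <ᵇ x)
<ᵇ-suc x z h = T-ext (λ t → <⇒<ᵇ (≤∧≢⇒< (≤-pred (<ᵇ⇒< z (suc x) t)) h))
  (λ t → <⇒<ᵇ (<-trans (<ᵇ⇒< z x t) (n<1+n x)))

<ᵇ-irrefl : ∀ x → (x <ᵇ x) ≡ false
<ᵇ-irrefl x = ¬T⇒≡false (<-irrefl refl ∘ <ᵇ⇒< x x)

Consecutive : ℕ → ℕ → Set
Consecutive x y = y ≡ suc x ⊎ x ≡ suc y

module _ (q : ℕ → ℕ) (Good : ℕ → Set) (q-injective : ∀ x y → Good x → Good y → q x ≡ q y → x ≡ y) where

  private
    q-≢ : ∀ {x y} → Good x → Good y → x ≢ y → q x ≢ q y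
    q-≢ gx gy h e = h (q-injective _ _ gx gy e)

  <ᵇ-adjTranspose-consecutive : ∀ a i j → 1 ≤ a → Good a → Good (suc a) → Good i → Good j →
    Consecutive (q a) (q (suc a)) →
    ¬ (i ≡ a × j ≡ suc a) → ¬ (i ≡ suc a × j ≡ a) →
    (q (adjTranspose a i) <ᵇ q (adjTranspose a j)) ≡ (q i <ᵇ q j)
  <ᵇ-adjTranspose-consecutive a i j 1≤a ga ga′ gi gj consecutive e₁ e₂
    with i ≟ a | i ≟ suc a | j ≟ a | j ≟ suc a
  ... | yes refl | _ | yes refl | _ = trans (<ᵇ-irrefl (q (adjTranspose a a))) (sym (<ᵇ-irrefl (q a)))
  ... | yes refl | _ | no _ | yes refl = ⊥-elim (e₁ (refl , refl))
  ... | yes refl | _ | no j₁ | no j₂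
    rewrite adjTranspose-left a 1≤a | adjTranspose-fixes a j j₁ j₂ with consecutive
  ...   | inj₁ h rewrite h = suc-<ᵇ (q a) (q j) (λ e → q-≢ gj ga′ j₂ (trans e (sym h)))
  ...   | inj₂ h rewrite h = sym (suc-<ᵇ (q (suc a)) (q j) (λ e → q-≢ gj ga j₁ (trans e (sym h))))
  <ᵇ-adjTranspose-consecutive a i j 1≤a ga ga′ gi gj consecutive e₁ e₂ | no _ | yes refl | yes refl | _ =
    ⊥-elim (e₂ (refl , refl))
  <ᵇ-adjTranspose-consecutive a i j 1≤a ga ga′ gi gj consecutive e₁ e₂ | no _ | yes refl | no _ | yes refl =
    trans (<ᵇ-irrefl (q (adjTranspose a (suc a)))) (sym (<ᵇ-irrefl (q (suc a))))
  <ᵇ-adjTranspose-consecutive a i j 1≤a ga ga′ gi gj consecutive e₁ e₂ | no _ | yes refl | no j₁ | no j₂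
    rewrite adjTranspose-right a 1≤a | adjTranspose-fixes a j j₁ j₂ with consecutive
  ...   | inj₁ h rewrite h = sym (suc-<ᵇ (q a) (q j) (λ e → q-≢ gj ga′ j₂ (trans e (sym h))))
  ...   | inj₂ h rewrite h = suc-<ᵇ (q (suc a)) (q j) (λ e → q-≢ gj ga j₁ (trans e (sym h)))
  <ᵇ-adjTranspose-consecutive a i j 1≤a ga ga′ gi gj consecutive e₁ e₂ | no i₁ | no i₂ | yes refl | _
    rewrite adjTranspose-left a 1≤a | adjTranspose-fixes a i i₁ i₂ with consecutive
  ...   | inj₁ h rewrite h = <ᵇ-suc (q a) (q i) (q-≢ gi ga i₁)
  ...   | inj₂ h rewrite h = sym (<ᵇ-suc (q (suc a)) (q i) (q-≢ gi ga′ i₂))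
  <ᵇ-adjTranspose-consecutive a i j 1≤a ga ga′ gi gj consecutive e₁ e₂ | no i₁ | no i₂ | no _ | yes refl
    rewrite adjTranspose-right a 1≤a | adjTranspose-fixes a i i₁ i₂ with consecutive
  ...   | inj₁ h rewrite h = sym (<ᵇ-suc (q a) (q i) (q-≢ gi ga i₁))
  ...   | inj₂ h rewrite h = <ᵇ-suc (q (suc a)) (q i) (q-≢ gi ga′ i₂)
  <ᵇ-adjTranspose-consecutive a i j 1≤a ga ga′ gi gj consecutive e₁ e₂ | no i₁ | no i₂ | no j₁ | no j₂
    rewrite adjTranspose-fixes a i i₁ i₂ | adjTranspose-fixes a j j₁ j₂ = refl

<ᵇ-adjTranspose : ∀ a i j → 1 ≤ a → ¬ (i ≡ a × j ≡ suc a) → ¬ (i ≡ suc a × j ≡ a) →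
  (adjTranspose a i <ᵇ adjTranspose a j) ≡ (i <ᵇ j)
<ᵇ-adjTranspose a i j 1≤a =
  <ᵇ-adjTranspose-consecutive (λ x → x) (λ _ → ⊤) (λ _ _ _ _ e → e) a i j 1≤a tt tt tt tt (inj₁ refl)

posOf-map : ∀ (g : ℕ → ℕ) π i → (∀ {x} → x ∈ π → (g x ≡ᵇ i) ≡ (x ≡ᵇ g i)) →
  posOf (map g π) i ≡ posOf π (g i)
posOf-map g []      i h = refl
posOf-map g (x ∷ π) i h rewrite h (here refl) | posOf-map g π i (h ∘ there) = refl

posOf-head : ∀ x ys → posOf (x ∷ ys) x ≡ 1
posOf-head x ys rewrite ≡ᵇ-refl x = refl

posOf-tail : ∀ x ys i → x ≢ i → posOf (x ∷ ys) i ≡ suc (posOf ys i)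
posOf-tail x ys i h rewrite ≢⇒≡ᵇ-false x i h = refl

posOf-∈-positive : ∀ π x → x ∈ π → 1 ≤ posOf π x
posOf-∈-positive (y ∷ π) x _ with y ≡ᵇ x
... | true  = s≤s z≤n
... | false = s≤s z≤n

posOf-∈-≤ : ∀ π i → i ∈ π → posOf π i ≤ length π
posOf-∈-≤ (y ∷ π) i m with y ≡ᵇ i in e
... | true  = s≤s z≤n
... | false with m
...   | here refl = ⊥-elim (≡false⇒¬T e (≡⇒≡ᵇ y y refl))
...   | there m′  = s≤s (posOf-∈-≤ π i m′)

posOf-injective : ∀ π x y → x ∈ π → y ∈ π → posOf π x ≡ posOf π y → x ≡ y
posOf-injective (z ∷ π) x y x∈ y∈ e with z ≡ᵇ x in ex | z ≡ᵇ y in ey | x∈ | y∈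
... | true  | true  | _         | _         = trans (sym (≡ᵇ⇒≡ z x (≡true⇒T ex))) (≡ᵇ⇒≡ z y (≡true⇒T ey))
... | true  | false | _         | here refl = ⊥-elim (≡false⇒¬T ey (≡⇒≡ᵇ z z refl))
... | true  | false | _         | there y∈′ = ⊥-elim (<-irrefl (cong pred e) (posOf-∈-positive π y y∈′))
... | false | true  | here refl | _         = ⊥-elim (≡false⇒¬T ex (≡⇒≡ᵇ z z refl))
... | false | true  | there x∈′ | _         = ⊥-elim (<-irrefl (cong pred (sym e)) (posOf-∈-positive π x x∈′))
... | false | false | here refl | _         = ⊥-elim (≡false⇒¬T ex (≡⇒≡ᵇ z z refl))
... | false | false | there _   | here refl = ⊥-elim (≡false⇒¬T ey (≡⇒≡ᵇ z z refl))
... | false | false | there x∈′ | there y∈′ = posOf-injective π x y x∈′ y∈′ (cong pred e)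

posOf-∷ʳ-∈ : ∀ L x i → i ∈ L → posOf (L ∷ʳ x) i ≡ posOf L i
posOf-∷ʳ-∈ (y ∷ L) x i m with y ≡ᵇ i in e
... | true = refl
... | false with m
...   | here refl = ⊥-elim (≡false⇒¬T e (≡⇒≡ᵇ y y refl))
...   | there m′  = cong suc (posOf-∷ʳ-∈ L x i m′)

posOf-∷ʳ-∉ : ∀ L x → x ∉ L → posOf (L ∷ʳ x) x ≡ suc (length L)
posOf-∷ʳ-∉ []      x _ rewrite ≡ᵇ-refl x = refl
posOf-∷ʳ-∉ (y ∷ L) x x∉ rewrite ≢⇒≡ᵇ-false y x (x∉ ∘ here ∘ sym) = cong suc (posOf-∷ʳ-∉ L x (x∉ ∘ there))

posOf-reverse : ∀ l i → Unique l → i ∈ l → posOf (reverse l) i ≡ suc (length l) ∸ posOf l i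
posOf-reverse (x ∷ l) i u m rewrite unfold-reverse x l with x ≡ᵇ i in e
... | true rewrite ≡ᵇ⇒≡ x i (≡true⇒T e) =
      trans (posOf-∷ʳ-∉ (reverse l) i (Unique[x∷xs]⇒x∉xs u ∘ ∈-resp-↭ (↭-reverse l)))
            (cong suc (length-reverse l))
... | false with m
...   | here refl = ⊥-elim (≡false⇒¬T e (≡⇒≡ᵇ x x refl))
...   | there m′  = trans (posOf-∷ʳ-∈ (reverse l) x i (∈-resp-↭ (↭-sym (↭-reverse l)) m′)) (posOf-reverse l i (AllPairs.tail u) m′)

unique-range : ∀ n → Unique (range n)
unique-range n = Unique.map⁺ suc-injective (Unique.upTo⁺ n)

module _ {n} {π : List ℕ} (π↭ : π ↭ range n) where

  ↭-range-unique : Unique π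
  ↭-range-unique = Permutationₛ.Unique-resp-↭ (setoid ℕ) (↭⇒↭ₛ (↭-sym π↭)) (unique-range n)

  ↭-range-∈⁻ : ∀ {x} → x ∈ π → InRange n x
  ↭-range-∈⁻ = ∈-range⁻ ∘ ∈-resp-↭ π↭

  ↭-range-∈⁺ : ∀ {x} → InRange n x → x ∈ π
  ↭-range-∈⁺ = ∈-resp-↭ (↭-sym π↭) ∘ ∈-range⁺

  ↭-range-length : length π ≡ n
  ↭-range-length = trans (↭-length π↭) (trans (length-map suc (upTo n)) (length-upTo n))

map-unique : ∀ (g : ℕ → ℕ) xs → (∀ {x y} → x ∈ xs → y ∈ xs → g x ≡ g y → x ≡ y) →
  Unique xs → Unique (map g xs)
map-unique g []       _   _        = AllPairs.[]
map-unique g (x ∷ xs) inj (x∉ ∷ u) =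
  All-map⁺ (All.tabulate (λ y∈ e → All.lookup x∉ y∈ (inj (here refl) (there y∈) e)))
  ∷ map-unique g xs (λ x∈ y∈ → inj (there x∈) (there y∈)) u

map-involution-range-↭ : ∀ n (s : ℕ → ℕ) →
  (∀ i → InRange n i → InRange n (s i)) → (∀ i → InRange n i → s (s i) ≡ i) →
  map s (range n) ↭ range n
map-involution-range-↭ n s s-range s-inv = ∼bag⇒↭ (unique∧set⇒bag
    (map-unique s (range n) injective (unique-range n)) (unique-range n)
    (mk⇔ (λ x∈ → let (i , i∈ , x≡) = ∈-map⁻ s x∈ in subst (_∈ range n) (sym x≡) (∈-range⁺ (s-range i (∈-range⁻ i∈))))
         (λ x∈ → subst (_∈ map s (range n)) (s-inv _ (∈-range⁻ x∈)) (∈-map⁺ s (∈-range⁺ (s-range _ (∈-range⁻ x∈)))))))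
  where
    injective : ∀ {x y} → x ∈ range n → y ∈ range n → s x ≡ s y → x ≡ y
    injective {x} {y} x∈ y∈ e = trans (sym (s-inv x (∈-range⁻ x∈))) (trans (cong s e) (s-inv y (∈-range⁻ y∈)))

perms-range-involution : ∀ n (s : ℕ → ℕ) →
  (∀ i → InRange n i → InRange n (s i)) → (∀ i → InRange n i → s (s i) ≡ i) →
  map (map s) (perms (range n)) ↭ perms (range n)
perms-range-involution n s s-range s-inv =
  ↭-trans (↭-reflexive (map-perms s (range n))) (perms-resp-↭ (map-involution-range-↭ n s s-range s-inv))

-- Invariance of Ω and A_P

record SameCounts (n : ℕ) (P Q : Rel) : Set where
  constructor sameCounts
  field
    Ω-≡        : ∀ m → Ω n P m ≡ Ω n Q m
    AP-coeff-≡ : ∀ k → AP-coeff n P k ≡ AP-coeff n Q k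

sameCounts-refl : ∀ {n P} → SameCounts n P P
sameCounts-refl = sameCounts (λ _ → refl) (λ _ → refl)

sameCounts-sym : ∀ {n P Q} → SameCounts n P Q → SameCounts n Q P
sameCounts-sym (sameCounts Ω≡ A≡) = sameCounts (sym ∘ Ω≡) (sym ∘ A≡)

sameCounts-trans : ∀ {n P Q R} → SameCounts n P Q → SameCounts n Q R → SameCounts n P R
sameCounts-trans (sameCounts Ω≡ A≡) (sameCounts Ω≡′ A≡′) =
  sameCounts (λ m → trans (Ω≡ m) (Ω≡′ m)) (λ k → trans (A≡ k) (A≡′ k))

sameCounts-cong : ∀ n P Q → (∀ i j → InRange n i → InRange n j → P i j ≡ Q i j) → SameCounts n P Q
sameCounts-cong n P Q P≡Q = sameCounts
    (λ m → count-cong _ _ (maps n m) (λ _ → all²-cong _ _ n same-condition))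
    (λ k → count-cong _ _ (perms (range n)) (λ {π} _ → cong (_∧ (suc (des π) ≡ᵇ k)) (all²-cong _ _ n same-condition)))
  where
    same-condition : ∀ {c : ℕ → ℕ → Bool} i j → InRange n i → InRange n j → (not (P i j) ∨ c i j) ≡ (not (Q i j) ∨ c i j)
    same-condition i j ri rj = cong (λ b → not b ∨ _) (P≡Q i j ri rj)

ppCompare : ℕ → ℕ → ℕ → ℕ → Bool
ppCompare i j x y = if i <ᵇ j then x ≤ᵇ y else x <ᵇ y

-- Exchanging two adjacent incomparable labels

relabel : ℕ → Rel → Rel
relabel a R x y = R (adjTranspose a x) (adjTranspose a y)

isStep : ℕ → ℕ → ℕ → Bool
isStep a x y = (x ≡ᵇ a) ∧ (y ≡ᵇ suc a)

isStep⁻ : ∀ a x y → T (isStep a x y) → x ≡ a × y ≡ suc a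
isStep⁻ a x y t = ≡ᵇ⇒≡ x a (T-∧ˡ t) , ≡ᵇ⇒≡ y (suc a) (T-∧ʳ {x ≡ᵇ a} t)

isStep⁺ : ∀ a → T (isStep a a (suc a))
isStep⁺ a = T-∧⁺ {a ≡ᵇ a} (≡⇒≡ᵇ a a refl) (≡⇒≡ᵇ (suc a) (suc a) refl)

neighbours : ℕ → List ℕ → Bool
neighbours a (x ∷ y ∷ ys) = (isStep a x y ∨ isStep a y x) ∨ neighbours a (y ∷ ys)
neighbours a _            = false

neighbours-map-adjTranspose : ∀ a π → 1 ≤ a → neighbours a (map (adjTranspose a) π) ≡ neighbours a π
neighbours-map-adjTranspose a []          _   = refl
neighbours-map-adjTranspose a (x ∷ [])    _   = refl
neighbours-map-adjTranspose a (x ∷ y ∷ ys) 1≤a =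
  cong₂ _∨_ (trans (cong₂ _∨_ (step x y) (step y x)) (∨-comm (isStep a y x) _))
            (neighbours-map-adjTranspose a (y ∷ ys) 1≤a)
  where
    step : ∀ x y → isStep a (adjTranspose a x) (adjTranspose a y) ≡ isStep a y x
    step x y rewrite ≡ᵇ-adjTranspose a x a | ≡ᵇ-adjTranspose a y (suc a)
                   | adjTranspose-left a 1≤a | adjTranspose-right a 1≤a = ∧-comm (x ≡ᵇ suc a) (y ≡ᵇ a)

des-map-adjTranspose : ∀ a π → 1 ≤ a → ¬ T (neighbours a π) → des (map (adjTranspose a) π) ≡ des π
des-map-adjTranspose a []           _   _ = refl
des-map-adjTranspose a (x ∷ [])     _   _ = refl
des-map-adjTranspose a (x ∷ y ∷ ys) 1≤a h = cong₂ _+_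
  (cong (λ b → if b then 1 else 0) (<ᵇ-adjTranspose a y x 1≤a
    (λ { (refl , refl) → h (T-∨ˡ (T-∨ʳ {isStep a x y} (isStep⁺ a))) })
    (λ { (refl , refl) → h (T-∨ˡ (T-∨ˡ (isStep⁺ a))) })))
  (des-map-adjTranspose a (y ∷ ys) 1≤a (h ∘ T-∨ʳ))

pair-∈ : ∀ a x y ys → T (isStep a x y ∨ isStep a y x) → a ∈ x ∷ y ∷ ys × suc a ∈ x ∷ y ∷ ys
pair-∈ a x y ys p with T-∨⁻ {isStep a x y} p
... | inj₁ st with isStep⁻ a x y st
...   | refl , refl = here refl , there (here refl)
pair-∈ a x y ys p | inj₂ st with isStep⁻ a y x st
...   | refl , refl = there (here refl) , here refl

pair-consecutive : ∀ a x y ys → T (isStep a x y ∨ isStep a y x) →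
  Consecutive (posOf (x ∷ y ∷ ys) a) (posOf (x ∷ y ∷ ys) (suc a))
pair-consecutive a x y ys p with T-∨⁻ {isStep a x y} p
... | inj₁ st with isStep⁻ a x y st
...   | refl , refl = inj₁ (trans (posOf-tail a (suc a ∷ ys) (suc a) (1+n≢n ∘ sym))
                           (cong suc (trans (posOf-head (suc a) ys) (sym (posOf-head a (suc a ∷ ys))))))
pair-consecutive a x y ys p | inj₂ st with isStep⁻ a y x st
...   | refl , refl = inj₂ (trans (posOf-tail (suc a) (a ∷ ys) a 1+n≢n)
                           (cong suc (trans (posOf-head a ys) (sym (posOf-head (suc a) (a ∷ ys))))))

neighbours-∈ : ∀ a π → T (neighbours a π) → a ∈ π × suc a ∈ π
neighbours-∈ a (x ∷ y ∷ ys) t =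
  [ pair-∈ a x y ys , ×-map there there ∘ neighbours-∈ a (y ∷ ys) ]′ (T-∨⁻ t)

consecutive-∷ : ∀ a x ys → a ∈ ys → suc a ∈ ys → x ∉ ys →
  Consecutive (posOf ys a) (posOf ys (suc a)) → Consecutive (posOf (x ∷ ys) a) (posOf (x ∷ ys) (suc a))
consecutive-∷ a x ys a∈ a+1∈ x∉ c =
  subst₂ Consecutive (sym (posOf-tail x ys a (λ { refl → x∉ a∈ })))
                     (sym (posOf-tail x ys (suc a) (λ { refl → x∉ a+1∈ })))
         (⊎-map (cong suc) (cong suc) c)

neighbours⇒consecutive : ∀ a π → Unique π → T (neighbours a π) → Consecutive (posOf π a) (posOf π (suc a))
neighbours⇒consecutive a (x ∷ y ∷ ys) u t = [ pair-consecutive a x y ys ,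
  (λ t′ → consecutive-∷ a x (y ∷ ys) (proj₁ (neighbours-∈ a (y ∷ ys) t′)) (proj₂ (neighbours-∈ a (y ∷ ys) t′))
      (Unique[x∷xs]⇒x∉xs u) (neighbours⇒consecutive a (y ∷ ys) (AllPairs.tail u) t′)) ]′ (T-∨⁻ t)

module _ {n a} (R : Rel) (1≤a : 1 ≤ a) (a<n : suc a ≤ n)
         (a≮a+1 : R a (suc a) ≡ false) (a+1≮a : R (suc a) a ≡ false) where

  private
    s : ℕ → ℕ
    s = adjTranspose a

    s-range : ∀ i → InRange n i → InRange n (s i)
    s-range i = adjTranspose-inRange n a i 1≤a a<n

    s-inv : ∀ i → InRange n i → s (s i) ≡ i
    s-inv i _ = adjTranspose-involutive a i

    not-a,a+1 : ∀ i j → T (R i j) → ¬ (i ≡ a × j ≡ suc a)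
    not-a,a+1 i j t (refl , refl) = ≡false⇒¬T a≮a+1 t

    not-a+1,a : ∀ i j → T (R i j) → ¬ (i ≡ suc a × j ≡ a)
    not-a+1,a i j t (refl , refl) = ≡false⇒¬T a+1≮a t

    isPPartition-swapAt : ∀ f → length f ≡ n →
      isPPartition n (relabel a R) (swapAt a f) ≡ isPPartition n R f
    isPPartition-swapAt f len = trans (all²-reindex _ n s s-range s-inv) (all²-cong _ _ n (λ i j _ _ → pointwise i j))
      where
        a<len : suc a ≤ length f
        a<len = subst (suc a ≤_) (sym len) a<n
        pointwise : ∀ i j →
          (not (R (s (s i)) (s (s j))) ∨ ppCompare (s i) (s j) (nth (swapAt a f) (s i)) (nth (swapAt a f) (s j)))
          ≡ (not (R i j) ∨ ppCompare i j (nth f i) (nth f j))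
        pointwise i j rewrite nth-swapAt a f (s i) 1≤a a<len | nth-swapAt a f (s j) 1≤a a<len
                            | adjTranspose-involutive a i | adjTranspose-involutive a j with R i j in e
        ... | false = refl
        ... | true rewrite <ᵇ-adjTranspose a i j 1≤a (not-a,a+1 i j (≡true⇒T e)) (not-a+1,a i j (≡true⇒T e)) = refl

    isLinExt-map-adjTranspose : ∀ π → isLinExt n (relabel a R) (map s π) ≡ isLinExt n R π
    isLinExt-map-adjTranspose π = trans (all²-reindex _ n s s-range s-inv) (all²-cong _ _ n (λ i j _ _ → pointwise i j))
      where
        pointwise : ∀ i j →
          (not (R (s (s i)) (s (s j))) ∨ (posOf (map s π) (s i) <ᵇ posOf (map s π) (s j)))
          ≡ (not (R i j) ∨ (posOf π i <ᵇ posOf π j))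
        pointwise i j rewrite posOf-map s π (s i) (λ {x} _ → ≡ᵇ-adjTranspose a x (s i))
                            | posOf-map s π (s j) (λ {x} _ → ≡ᵇ-adjTranspose a x (s j))
                            | adjTranspose-involutive a i | adjTranspose-involutive a j = refl

    -- When a and a + 1 are neighbours in π, exchanging them moves no other letter past either.
    isLinExt-relabel-neighbours : ∀ π → π ↭ range n → T (neighbours a π) →
      isLinExt n (relabel a R) π ≡ isLinExt n R π
    isLinExt-relabel-neighbours π π↭ t = trans (all²-reindex _ n s s-range s-inv) (all²-cong _ _ n pointwise)
      where
        a-range : InRange n a
        a-range = 1≤a , ≤-trans (n≤1+n a) a<n
        pointwise : ∀ i j → InRange n i → InRange n j →
          (not (R (s (s i)) (s (s j))) ∨ (posOf π (s i) <ᵇ posOf π (s j)))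
          ≡ (not (R i j) ∨ (posOf π i <ᵇ posOf π j))
        pointwise i j ri rj rewrite adjTranspose-involutive a i | adjTranspose-involutive a j with R i j in e
        ... | false = refl
        ... | true rewrite <ᵇ-adjTranspose-consecutive (posOf π) (InRange n)
                             (λ x y rx ry → posOf-injective π x y (↭-range-∈⁺ π↭ rx) (↭-range-∈⁺ π↭ ry))
                             a i j 1≤a a-range (s≤s z≤n , a<n) ri rj
                             (neighbours⇒consecutive a π (↭-range-unique π↭) t)
                             (not-a,a+1 i j (≡true⇒T e)) (not-a+1,a i j (≡true⇒T e)) = refl

  Ω-relabel : ∀ m → Ω n (relabel a R) m ≡ Ω n R m
  Ω-relabel m = begin
      count (isPPartition n (relabel a R)) (maps n m)
        ≡⟨ cong (count _) (maps≡words n m) ⟩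
      count (isPPartition n (relabel a R)) W
        ≡⟨ count-↭ _ (↭-sym (map-swapAt-words a n (range m) 1≤a a<n)) ⟩
      count (isPPartition n (relabel a R)) (map (swapAt a) W)
        ≡⟨ count-map _ (swapAt a) W ⟩
      count (isPPartition n (relabel a R) ∘ swapAt a) W
        ≡⟨ count-cong _ _ W (λ f∈ → isPPartition-swapAt _ (proj₁ (∈-words⁻ n (range m) f∈))) ⟩
      count (isPPartition n R) W
        ≡⟨ cong (count _) (maps≡words n m) ⟨
      count (isPPartition n R) (maps n m) ∎
    where
      open ≡-Reasoning
      W : List (List ℕ)
      W = words n (range m)

  -- Split the permutations according to whether a and a + 1 are neighbours: those that are
  -- keep their descents, and the transposition maps those that are not bijectively onto themselves.
  AP-coeff-relabel : ∀ k → AP-coeff n (relabel a R) k ≡ AP-coeff n R k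
  AP-coeff-relabel k = begin
      count b′ Π
        ≡⟨ count-split b′ (neighbours a) Π ⟩
      count (λ π → neighbours a π ∧ b′ π) Π + count (λ π → not (neighbours a π) ∧ b′ π) Π
        ≡⟨ cong₂ _+_ (count-cong _ _ Π (λ π∈ → together _ (∈-perms⁻ π∈))) apart ⟩
      count (λ π → neighbours a π ∧ b π) Π + count (λ π → not (neighbours a π) ∧ b π) Π
        ≡⟨ count-split b (neighbours a) Π ⟨
      count b Π ∎
    where
      open ≡-Reasoning
      Π : List (List ℕ)
      Π = perms (range n)
      b′ b : List ℕ → Bool
      b′ π = isLinExt n (relabel a R) π ∧ (suc (des π) ≡ᵇ k)
      b  π = isLinExt n R π ∧ (suc (des π) ≡ᵇ k)
      together : ∀ π → π ↭ range n → (neighbours a π ∧ b′ π) ≡ (neighbours a π ∧ b π)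
      together π π↭ with neighbours a π in e
      ... | false = refl
      ... | true rewrite isLinExt-relabel-neighbours π π↭ (≡true⇒T e) = refl
      apart-pointwise : ∀ π → (not (neighbours a (map s π)) ∧ b′ (map s π)) ≡ (not (neighbours a π) ∧ b π)
      apart-pointwise π rewrite neighbours-map-adjTranspose a π 1≤a | isLinExt-map-adjTranspose π
        with neighbours a π in e
      ... | true  = refl
      ... | false rewrite des-map-adjTranspose a π 1≤a (≡false⇒¬T e) = refl
      apart : count (λ π → not (neighbours a π) ∧ b′ π) Π ≡ count (λ π → not (neighbours a π) ∧ b π) Π
      apart = trans (count-↭ _ (↭-sym (perms-range-involution n s s-range s-inv)))
                    (trans (count-map _ (map s) Π) (count-cong _ _ Π (λ {π} _ → apart-pointwise π)))

  sameCounts-relabel : SameCounts n (relabel a R) R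
  sameCounts-relabel = sameCounts Ω-relabel AP-coeff-relabel

-- Reversing the labels and the order: x ↦ n + 1 − x

complement : ℕ → ℕ → ℕ
complement n x = suc n ∸ x

complement-involutive : ∀ n x → InRange n x → complement n (complement n x) ≡ x
complement-involutive n x (_ , x≤n) = m∸[m∸n]≡n (≤-trans x≤n (n≤1+n n))

complement-inRange : ∀ n x → InRange n x → InRange n (complement n x)
complement-inRange n x (1≤x , x≤n) = m<n⇒0<n∸m (s≤s x≤n) , ∸-monoʳ-≤ (suc n) 1≤x

complement-<ᵇ : ∀ n x y → x ≤ n → y ≤ n → (complement n x <ᵇ complement n y) ≡ (y <ᵇ x)
complement-<ᵇ n x y x≤n y≤n = T-ext
  (λ t → <⇒<ᵇ (≰⇒> {x} {y} (λ x≤y → <⇒≱ (<ᵇ⇒< (complement n x) (complement n y) t) (∸-monoʳ-≤ (suc n) x≤y))))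
  (λ t → <⇒<ᵇ (∸-monoʳ-< (<ᵇ⇒< y x t) (≤-trans x≤n (n≤1+n n))))

complement-≤ᵇ : ∀ n x y → x ≤ n → y ≤ n → (complement n x ≤ᵇ complement n y) ≡ (y ≤ᵇ x)
complement-≤ᵇ n x y x≤n y≤n = T-ext
  (λ t → ≤⇒≤ᵇ (≮⇒≥ (λ x<y → <⇒≱ (∸-monoʳ-< x<y (≤-trans y≤n (n≤1+n n))) (≤ᵇ⇒≤ (complement n x) (complement n y) t))))
  (λ t → ≤⇒≤ᵇ (∸-monoʳ-≤ (suc n) (≤ᵇ⇒≤ y x t)))

complement-≡ᵇ : ∀ n x i → InRange n x → InRange n i → (complement n x ≡ᵇ i) ≡ (x ≡ᵇ complement n i)
complement-≡ᵇ n x i rx ri = T-ext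
  (λ t → ≡⇒≡ᵇ x (complement n i) (trans (sym (complement-involutive n x rx)) (cong (complement n) (≡ᵇ⇒≡ (complement n x) i t))))
  (λ t → ≡⇒≡ᵇ (complement n x) i (trans (cong (complement n) (≡ᵇ⇒≡ x (complement n i) t)) (complement-involutive n i ri)))

complementDual : ℕ → Rel → Rel
complementDual n R x y = R (complement n y) (complement n x)

nth-∷ʳ-init : ∀ L x i → 1 ≤ i → i ≤ length L → nth (L ∷ʳ x) i ≡ nth L i
nth-∷ʳ-init (y ∷ L) x (suc zero)    _ _       = refl
nth-∷ʳ-init (y ∷ L) x (suc (suc i)) _ (s≤s i≤) = nth-∷ʳ-init L x (suc i) (s≤s z≤n) i≤

nth-∷ʳ-last : ∀ L x → nth (L ∷ʳ x) (suc (length L)) ≡ x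
nth-∷ʳ-last []      x = refl
nth-∷ʳ-last (y ∷ L) x = nth-∷ʳ-last L x

nth-reverse : ∀ l i → InRange (length l) i → nth (reverse l) i ≡ nth l (complement (length l) i)
nth-reverse []      zero    (() , _)
nth-reverse []      (suc _) (_ , ())
nth-reverse (x ∷ l) i (1≤i , i≤) rewrite unfold-reverse x l with m≤n⇒m<n∨m≡n i≤
... | inj₂ refl = begin
    nth (reverse l ∷ʳ x) (suc (length l))          ≡⟨ cong (λ k → nth (reverse l ∷ʳ x) (suc k)) (length-reverse l) ⟨
    nth (reverse l ∷ʳ x) (suc (length (reverse l))) ≡⟨ nth-∷ʳ-last (reverse l) x ⟩
    x                                               ≡⟨ cong (nth (x ∷ l)) (m+n∸n≡m 1 (suc (length l))) ⟨
    nth (x ∷ l) (complement (suc (length l)) (suc (length l))) ∎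
  where open ≡-Reasoning
... | inj₁ (s≤s i≤l) = begin
    nth (reverse l ∷ʳ x) i              ≡⟨ nth-∷ʳ-init (reverse l) x i 1≤i (subst (i ≤_) (sym (length-reverse l)) i≤l) ⟩
    nth (reverse l) i                   ≡⟨ nth-reverse l i (1≤i , i≤l) ⟩
    nth l (suc (length l) ∸ i)              ≡⟨ cong (nth l) (+-∸-assoc 1 i≤l) ⟩
    nth (x ∷ l) (suc (suc (length l ∸ i)))   ≡⟨ cong (λ k → nth (x ∷ l) (suc k)) (+-∸-assoc 1 i≤l) ⟨
    nth (x ∷ l) (suc (suc (length l) ∸ i))   ≡⟨ cong (nth (x ∷ l)) (+-∸-assoc 1 (≤-trans i≤l (n≤1+n _))) ⟨
    nth (x ∷ l) (suc (suc (length l)) ∸ i)   ∎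
  where open ≡-Reasoning

nth-map : ∀ (g : ℕ → ℕ) f i → 1 ≤ i → i ≤ length f → nth (map g f) i ≡ g (nth f i)
nth-map g (y ∷ f) (suc zero)    _ _       = refl
nth-map g (y ∷ f) (suc (suc i)) _ (s≤s i≤) = nth-map g f (suc i) (s≤s z≤n) i≤

nth-∈ : ∀ f i → 1 ≤ i → i ≤ length f → nth f i ∈ f
nth-∈ (y ∷ f) (suc zero)    _ _       = here refl
nth-∈ (y ∷ f) (suc (suc i)) _ (s≤s i≤) = there (nth-∈ f (suc i) (s≤s z≤n) i≤)

nth-++ˡ : ∀ xs ys i → 1 ≤ i → i ≤ length xs → nth (xs ++ ys) i ≡ nth xs i
nth-++ˡ (x ∷ xs) ys (suc zero)    _ _       = refl
nth-++ˡ (x ∷ xs) ys (suc (suc i)) _ (s≤s i≤) = nth-++ˡ xs ys (suc i) (s≤s z≤n) i≤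

nth-++ʳ : ∀ xs ys i → length xs < i → nth (xs ++ ys) i ≡ nth ys (i ∸ length xs)
nth-++ʳ []       ys i             _         = refl
nth-++ʳ (x ∷ xs) ys (suc (suc i)) (s≤s l<i) = nth-++ʳ xs ys (suc i) l<i

countAdjacent : (ℕ → ℕ → Bool) → List ℕ → ℕ
countAdjacent r (x ∷ y ∷ ys) = (if r x y then 1 else 0) + countAdjacent r (y ∷ ys)
countAdjacent r _            = 0

des≡countAdjacent : ∀ l → des l ≡ countAdjacent (λ x y → y <ᵇ x) l
des≡countAdjacent []           = refl
des≡countAdjacent (x ∷ [])     = refl
des≡countAdjacent (x ∷ y ∷ ys) = cong ((if y <ᵇ x then 1 else 0) +_) (des≡countAdjacent (y ∷ ys))

countAdjacent-∷ʳ : ∀ r L y x →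
  countAdjacent r ((L ∷ʳ y) ∷ʳ x) ≡ countAdjacent r (L ∷ʳ y) + (if r y x then 1 else 0)
countAdjacent-∷ʳ r []           y x = +-comm (if r y x then 1 else 0) 0
countAdjacent-∷ʳ r (z ∷ [])     y x = begin
    rzy + (ryx + 0) ≡⟨ cong (rzy +_) (+-identityʳ ryx) ⟩
    rzy + ryx       ≡⟨ cong (_+ ryx) (+-identityʳ rzy) ⟨
    rzy + 0 + ryx   ∎
  where
    open ≡-Reasoning
    rzy ryx : ℕ
    rzy = if r z y then 1 else 0
    ryx = if r y x then 1 else 0
countAdjacent-∷ʳ r (z ∷ w ∷ L) y x = trans (cong ((if r z w then 1 else 0) +_) (countAdjacent-∷ʳ r (w ∷ L) y x))
  (sym (+-assoc (if r z w then 1 else 0) (countAdjacent r (w ∷ L ∷ʳ y)) (if r y x then 1 else 0)))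

countAdjacent-reverse : ∀ r l → countAdjacent r (reverse l) ≡ countAdjacent (λ x y → r y x) l
countAdjacent-reverse r []           = refl
countAdjacent-reverse r (x ∷ [])     = refl
countAdjacent-reverse r (x ∷ y ∷ ys) = begin
    countAdjacent r (reverse (x ∷ y ∷ ys))
      ≡⟨ cong (countAdjacent r) (trans (unfold-reverse x (y ∷ ys)) (cong (_∷ʳ x) (unfold-reverse y ys))) ⟩
    countAdjacent r ((reverse ys ∷ʳ y) ∷ʳ x)
      ≡⟨ countAdjacent-∷ʳ r (reverse ys) y x ⟩
    countAdjacent r (reverse ys ∷ʳ y) + ryx
      ≡⟨ cong (_+ ryx) (trans (cong (countAdjacent r) (sym (unfold-reverse y ys))) (countAdjacent-reverse r (y ∷ ys))) ⟩
    countAdjacent (λ u v → r v u) (y ∷ ys) + ryx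
      ≡⟨ +-comm (countAdjacent (λ u v → r v u) (y ∷ ys)) ryx ⟩
    countAdjacent (λ u v → r v u) (x ∷ y ∷ ys) ∎
  where
    open ≡-Reasoning
    ryx : ℕ
    ryx = if r y x then 1 else 0

countAdjacent-map : ∀ r (g : ℕ → ℕ) l → countAdjacent r (map g l) ≡ countAdjacent (λ x y → r (g x) (g y)) l
countAdjacent-map r g []           = refl
countAdjacent-map r g (x ∷ [])     = refl
countAdjacent-map r g (x ∷ y ∷ ys) = cong ((if r (g x) (g y) then 1 else 0) +_) (countAdjacent-map r g (y ∷ ys))

countAdjacent-cong : ∀ r r′ l → (∀ {x y} → x ∈ l → y ∈ l → r x y ≡ r′ x y) → countAdjacent r l ≡ countAdjacent r′ l
countAdjacent-cong r r′ []           h = refl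
countAdjacent-cong r r′ (x ∷ [])     h = refl
countAdjacent-cong r r′ (x ∷ y ∷ ys) h = cong₂ (λ b c → (if b then 1 else 0) + c) (h (here refl) (there (here refl)))
  (countAdjacent-cong r r′ (y ∷ ys) (λ x∈ y∈ → h (there x∈) (there y∈)))

des-reverse-complement : ∀ n π → (∀ {x} → x ∈ π → InRange n x) → des (reverse (map (complement n) π)) ≡ des π
des-reverse-complement n π π⊆ = begin
    des (reverse (map (complement n) π))
      ≡⟨ des≡countAdjacent (reverse (map (complement n) π)) ⟩
    countAdjacent (λ x y → y <ᵇ x) (reverse (map (complement n) π))
      ≡⟨ countAdjacent-reverse _ (map (complement n) π) ⟩
    countAdjacent _<ᵇ_ (map (complement n) π)
      ≡⟨ countAdjacent-map _ (complement n) π ⟩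
    countAdjacent (λ x y → complement n x <ᵇ complement n y) π
      ≡⟨ countAdjacent-cong _ _ π (λ x∈ y∈ → complement-<ᵇ n _ _ (proj₂ (π⊆ x∈)) (proj₂ (π⊆ y∈))) ⟩
    countAdjacent (λ x y → y <ᵇ x) π
      ≡⟨ des≡countAdjacent π ⟨
    des π ∎
  where open ≡-Reasoning

module _ (n : ℕ) (R : Rel) where

  private
    c : ℕ → ℕ
    c = complement n

    c-range : ∀ i → InRange n i → InRange n (c i)
    c-range = complement-inRange n

    c-inv : ∀ i → InRange n i → c (c i) ≡ i
    c-inv = complement-involutive n

    all²-complementDual : ∀ (G : ℕ → ℕ → Bool) → all² (λ i j → G (c j) (c i)) n ≡ all² G n
    all²-complementDual G = trans (sym (all²-reindex (λ i j → G j i) n c c-range c-inv)) (sym (all²-transpose G n))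

  -- π ↦ reverse (map c π) maps linear extensions of R to those of its dual, preserving descents.
  AP-coeff-complementDual : ∀ k → AP-coeff n (complementDual n R) k ≡ AP-coeff n R k
  AP-coeff-complementDual k = begin
      count b′ Π                 ≡⟨ count-↭ b′ (↭-sym Π↭) ⟩
      count b′ (map F Π)         ≡⟨ count-map b′ F Π ⟩
      count (b′ ∘ F) Π           ≡⟨ count-cong _ _ Π (λ π∈ → pointwise _ (∈-perms⁻ π∈)) ⟩
      count b Π                  ∎
    where
      open ≡-Reasoning
      Π : List (List ℕ)
      Π = perms (range n)
      F : List ℕ → List ℕ
      F π = reverse (map c π)
      b′ b : List ℕ → Bool
      b′ π = isLinExt n (complementDual n R) π ∧ (suc (des π) ≡ᵇ k)
      b  π = isLinExt n R π ∧ (suc (des π) ≡ᵇ k)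
      Π↭ : map F Π ↭ Π
      Π↭ = ↭-trans (↭-reflexive (map-∘ Π)) (↭-trans (map⁺ reverse (perms-range-involution n c c-range c-inv))
                                                    (map-reverse-perms (range n)))
      pointwise : ∀ π → π ↭ range n → b′ (F π) ≡ b π
      pointwise π π↭ = cong₂ (λ u v → u ∧ (suc v ≡ᵇ k)) linExt (des-reverse-complement n π (↭-range-∈⁻ π↭))
        where
          cπ↭ : map c π ↭ range n
          cπ↭ = ↭-trans (map⁺ c π↭) (map-involution-range-↭ n c c-range c-inv)
          posOf-F : ∀ i → InRange n i → posOf (F π) i ≡ c (posOf π (c i))
          posOf-F i ri = trans (posOf-reverse (map c π) i (↭-range-unique cπ↭) (↭-range-∈⁺ cπ↭ ri))
            (cong₂ (λ u v → suc u ∸ v) (↭-range-length cπ↭)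
                   (posOf-map c π i (λ x∈ → complement-≡ᵇ n _ i (↭-range-∈⁻ π↭ x∈) ri)))
          posOf-≤ : ∀ i → InRange n i → posOf π i ≤ n
          posOf-≤ i ri = subst (posOf π i ≤_) (↭-range-length π↭) (posOf-∈-≤ π i (↭-range-∈⁺ π↭ ri))
          linExt : isLinExt n (complementDual n R) (F π) ≡ isLinExt n R π
          linExt = trans
            (all²-cong _ _ n (λ i j ri rj → cong (not (R (c j) (c i)) ∨_)
              (trans (cong₂ _<ᵇ_ (posOf-F i ri) (posOf-F j rj))
                     (complement-<ᵇ n _ _ (posOf-≤ (c i) (c-range i ri)) (posOf-≤ (c j) (c-range j rj))))))
            (all²-complementDual (λ x y → not (R x y) ∨ (posOf π x <ᵇ posOf π y)))

  -- f ↦ (i ↦ m + 1 − f (n + 1 − i)) maps R-partitions to partitions of its dual.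
  Ω-complementDual : ∀ m → Ω n (complementDual n R) m ≡ Ω n R m
  Ω-complementDual m = begin
      count (isPPartition n (complementDual n R)) (maps n m)
        ≡⟨ cong (count _) (maps≡words n m) ⟩
      count (isPPartition n (complementDual n R)) W
        ≡⟨ count-↭ _ (↭-sym W↭) ⟩
      count (isPPartition n (complementDual n R)) (map G W)
        ≡⟨ count-map _ G W ⟩
      count (isPPartition n (complementDual n R) ∘ G) W
        ≡⟨ count-cong _ _ W (λ f∈ → let (len , letters) = ∈-words⁻ n (range m) f∈ in
                                     pointwise _ len (∈-range⁻ ∘ letters)) ⟩
      count (isPPartition n R) W
        ≡⟨ cong (count _) (maps≡words n m) ⟨
      count (isPPartition n R) (maps n m) ∎
    where
      open ≡-Reasoning
      W : List (List ℕ)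
      W = words n (range m)
      G : List ℕ → List ℕ
      G f = reverse (map (complement m) f)
      W↭ : map G W ↭ W
      W↭ = ↭-trans (↭-reflexive (trans (map-∘ W) (cong (map reverse) (map-words (complement m) n (range m)))))
             (↭-trans (map⁺ reverse (words-resp-↭ n (map-involution-range-↭ m (complement m)
                                       (complement-inRange m) (complement-involutive m))))
                      (map-reverse-words n (range m)))
      pointwise : ∀ f → length f ≡ n → (∀ {x} → x ∈ f → InRange m x) →
        isPPartition n (complementDual n R) (G f) ≡ isPPartition n R f
      pointwise f len f⊆ = trans
          (all²-cong _ _ n (λ i j ri rj → cong (not (R (c j) (c i)) ∨_) (reversed i j ri rj)))
          (all²-complementDual (λ x y → not (R x y) ∨ ppCompare x y (nth f x) (nth f y)))
        where
          len′ : length (map (complement m) f) ≡ n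
          len′ = trans (length-map (complement m) f) len
          nth-G : ∀ i → InRange n i → nth (G f) i ≡ complement m (nth f (c i))
          nth-G i ri = trans (nth-reverse (map (complement m) f) i (subst (λ l → InRange l i) (sym len′) ri))
            (trans (cong (λ l → nth (map (complement m) f) (suc l ∸ i)) len′)
                   (nth-map (complement m) f (c i) (proj₁ (c-range i ri)) (subst (c i ≤_) (sym len) (proj₂ (c-range i ri)))))
          value≤ : ∀ i → InRange n i → nth f i ≤ m
          value≤ i (1≤i , i≤n) = proj₂ (f⊆ (nth-∈ f i 1≤i (subst (i ≤_) (sym len) i≤n)))
          reversed : ∀ i j → InRange n i → InRange n j →
            ppCompare i j (nth (G f) i) (nth (G f) j) ≡ ppCompare (c j) (c i) (nth f (c j)) (nth f (c i))
          reversed i j ri rj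
            rewrite nth-G i ri | nth-G j rj
                  | complement-≤ᵇ m (nth f (c i)) (nth f (c j)) (value≤ _ (c-range i ri)) (value≤ _ (c-range j rj))
                  | complement-<ᵇ m (nth f (c i)) (nth f (c j)) (value≤ _ (c-range i ri)) (value≤ _ (c-range j rj))
                  | complement-<ᵇ n j i (proj₂ rj) (proj₂ ri) = refl

  sameCounts-complementDual : SameCounts n (complementDual n R) R
  sameCounts-complementDual = sameCounts Ω-complementDual AP-coeff-complementDual

odd : ℕ → Bool
odd zero          = false
odd (suc zero)    = true
odd (suc (suc k)) = odd k

%2-suc-suc : ∀ k → suc (suc k) % 2 ≡ k % 2
%2-suc-suc k = trans (cong (_% 2) (+-comm 2 k)) ([m+n]%n≡m%n k 2)

isOdd≡odd : ∀ k → isOdd k ≡ odd k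
isOdd≡odd zero          = refl
isOdd≡odd (suc zero)    = refl
isOdd≡odd (suc (suc k)) = trans (cong (_≡ᵇ 1) (%2-suc-suc k)) (isOdd≡odd k)

isEven≡not-odd : ∀ k → isEven k ≡ not (odd k)
isEven≡not-odd zero          = refl
isEven≡not-odd (suc zero)    = refl
isEven≡not-odd (suc (suc k)) = trans (cong (_≡ᵇ 0) (%2-suc-suc k)) (isEven≡not-odd k)

T-isOdd : ∀ x → T (isOdd x) → odd x ≡ true
T-isOdd x t = trans (sym (isOdd≡odd x)) (T⇒≡true t)

T-isEven : ∀ x → T (isEven x) → odd x ≡ false
T-isEven x t = trans (sym (not-involutive (odd x))) (cong not (trans (sym (isEven≡not-odd x)) (T⇒≡true t)))

odd-suc : ∀ k → odd (suc k) ≡ not (odd k)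
odd-suc zero          = refl
odd-suc (suc zero)    = refl
odd-suc (suc (suc k)) = odd-suc k

odd-suc-flip : ∀ k {b} → odd k ≡ b → odd (suc k) ≡ not b
odd-suc-flip k e = trans (odd-suc k) (cong not e)

odd-pred-flip : ∀ k {b} → odd (suc k) ≡ b → odd k ≡ not b
odd-pred-flip k {b} e = trans (sym (not-involutive (odd k))) (cong not (trans (sym (odd-suc k)) e))

even⇒2≤ : ∀ k → odd k ≡ false → 1 ≤ k → 2 ≤ k
even⇒2≤ (suc zero)    () _
even⇒2≤ (suc (suc k)) _  _ = s≤s (s≤s z≤n)

odd⇒3≤ : ∀ k → odd k ≡ true → k ≢ 1 → 3 ≤ k
odd⇒3≤ (suc zero)          _  h = ⊥-elim (h refl)
odd⇒3≤ (suc (suc zero))    ()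
odd⇒3≤ (suc (suc (suc k))) _  _ = s≤s (s≤s (s≤s z≤n))

odd-dichotomy : ∀ k → odd k ≡ true ⊎ odd k ≡ false
odd-dichotomy k with odd k
... | true  = inj₁ refl
... | false = inj₂ refl

ε-even : ∀ n k → odd k ≡ false → 2 ≤ k → suc k ≤ n → ε n k ≡ suc k
ε-even n k e 2≤k k<n rewrite isEven≡not-odd k | e | ≤⇒≤ᵇ-true 2≤k | ≤⇒≤ᵇ-true k<n = refl

ε-odd : ∀ n k → odd k ≡ true → 3 ≤ k → k ≤ n → ε n k ≡ k ∸ 1
ε-odd n k e 3≤k k≤n rewrite isEven≡not-odd k | isOdd≡odd k | e | ≤⇒≤ᵇ-true 3≤k | ≤⇒≤ᵇ-true k≤n = refl

ε-even-last : ∀ n k → odd k ≡ false → ¬ suc k ≤ n → ε n k ≡ k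
ε-even-last n k e k≮n rewrite isEven≡not-odd k | isOdd≡odd k | e | ≰⇒≤ᵇ-false k≮n with 2 ≤ᵇ k
... | true  = refl
... | false = refl

o-odd : ∀ n k → odd k ≡ true → suc k ≤ n → o n k ≡ suc k
o-odd n k e k<n rewrite isOdd≡odd k | e | ≤⇒≤ᵇ-true k<n = refl

o-even : ∀ n k → odd k ≡ false → 2 ≤ k → k ≤ n → o n k ≡ k ∸ 1
o-even n k e 2≤k k≤n rewrite isOdd≡odd k | isEven≡not-odd k | e | ≤⇒≤ᵇ-true 2≤k | ≤⇒≤ᵇ-true k≤n = refl

o-odd-last : ∀ n k → odd k ≡ true → ¬ suc k ≤ n → o n k ≡ k
o-odd-last n k e k≮n rewrite isOdd≡odd k | isEven≡not-odd k | e | ≰⇒≤ᵇ-false k≮n = refl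

ε-involution : ∀ n i → InRange n i → InRange n (ε n i) × ε n (ε n i) ≡ i
ε-involution n i (1≤i , i≤n) with odd-dichotomy i
... | inj₂ even with suc i ≤? n
...   | yes i<n rewrite ε-even n i even (even⇒2≤ i even 1≤i) i<n =
        (s≤s z≤n , i<n) , ε-odd n (suc i) (odd-suc-flip i even) (s≤s (even⇒2≤ i even 1≤i)) i<n
...   | no i≮n rewrite ε-even-last n i even i≮n | ε-even-last n i even i≮n = (1≤i , i≤n) , refl
ε-involution n i (1≤i , i≤n) | inj₁ odd-i with i ≟ 1
...   | yes refl = (1≤i , i≤n) , refl
...   | no i≢1 rewrite ε-odd n i odd-i (odd⇒3≤ i odd-i i≢1) i≤n with i | odd⇒3≤ i odd-i i≢1 | odd-i
...     | suc j | s≤s 2≤j | odd-j = (≤-trans (s≤s z≤n) 2≤j , ≤-trans (n≤1+n j) i≤n) , ε-even n j (odd-pred-flip j odd-j) 2≤j i≤n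

o-involution : ∀ n i → InRange n i → InRange n (o n i) × o n (o n i) ≡ i
o-involution n i (1≤i , i≤n) with odd-dichotomy i
... | inj₁ odd-i with suc i ≤? n
...   | yes i<n rewrite o-odd n i odd-i i<n =
        (s≤s z≤n , i<n) , o-even n (suc i) (odd-suc-flip i odd-i) (s≤s 1≤i) i<n
...   | no i≮n rewrite o-odd-last n i odd-i i≮n | o-odd-last n i odd-i i≮n = (1≤i , i≤n) , refl
o-involution n i (1≤i , i≤n) | inj₂ even rewrite o-even n i even (even⇒2≤ i even 1≤i) i≤n
  with i | even⇒2≤ i even 1≤i | even
... | suc j | s≤s 1≤j | even-i = (1≤j , ≤-trans (n≤1+n j) i≤n) , o-odd n j (odd-pred-flip j even-i) i≤n

NoChains : Rel → Set
NoChains g = ∀ x y z → T (g x y) → T (g y z) → ⊥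

iter-noChains : ∀ n g → NoChains g → ∀ k (R : Rel) → (∀ x y → R x y ≡ g x y) → ∀ x y → iter n k g R x y ≡ g x y
iter-noChains n g no-chains zero    R R≡g x y = R≡g x y
iter-noChains n g no-chains (suc k) R R≡g x y = iter-noChains n g no-chains k (closureStep n g R) step≡g x y
  where
    no-two-steps : ∀ x z y → (R x y ∧ g y z) ≡ false
    no-two-steps x z y rewrite R≡g x y with g x y in e
    ... | false = refl
    ... | true  = ¬T⇒≡false (no-chains x y z (≡true⇒T e))
    step≡g : ∀ x z → closureStep n g R x z ≡ g x z
    step≡g x z = trans (cong₂ _∨_ (R≡g x z) (any-range-false _ n (no-two-steps x z))) (∨-identityʳ (g x z))

generated-noChains : ∀ n g → NoChains g → ∀ x y → generated n g x y ≡ g x y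
generated-noChains n g no-chains = iter-noChains n g no-chains n g (λ _ _ → refl)

zigGen-parity : ∀ n x y → T (zigGen n x y) → odd x ≡ true × odd y ≡ false
zigGen-parity n x y t with T-∨⁻ {(y ≡ᵇ suc x) ∧ isOdd x} (T-∧ʳ {inRange n y} (T-∧ʳ {inRange n x} t))
... | inj₁ up with ≡ᵇ⇒≡ y (suc x) (T-∧ˡ up)
...   | refl = odd-x , odd-suc-flip x odd-x
  where
    odd-x : odd x ≡ true
    odd-x = T-isOdd x (T-∧ʳ {y ≡ᵇ suc x} up)
zigGen-parity n x y t | inj₂ down with ≡ᵇ⇒≡ x (suc y) (T-∧ˡ down)
...   | refl = odd-suc-flip y even-y , even-y
  where
    even-y : odd y ≡ false
    even-y = T-isEven y (T-∧ʳ {x ≡ᵇ suc y} down)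

zigBarGen-parity : ∀ n x y → T (zigBarGen n x y) → odd x ≡ false × odd y ≡ true
zigBarGen-parity n x y t with T-∨⁻ {(x ≡ᵇ suc y) ∧ isOdd y} (T-∧ʳ {inRange n y} (T-∧ʳ {inRange n x} t))
... | inj₁ down with ≡ᵇ⇒≡ x (suc y) (T-∧ˡ down)
...   | refl = odd-suc-flip y odd-y , odd-y
  where
    odd-y : odd y ≡ true
    odd-y = T-isOdd y (T-∧ʳ {x ≡ᵇ suc y} down)
zigBarGen-parity n x y t | inj₂ up with ≡ᵇ⇒≡ y (suc x) (T-∧ˡ up)
...   | refl = even-x , odd-suc-flip x even-x
  where
    even-x : odd x ≡ false
    even-x = T-isEven x (T-∧ʳ {y ≡ᵇ suc x} up)

zigGen-noChains : ∀ n → NoChains (zigGen n)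
zigGen-noChains n x y z t₁ t₂ = true≢false (proj₁ (zigGen-parity n y z t₂)) (proj₂ (zigGen-parity n x y t₁))

zigBarGen-noChains : ∀ n → NoChains (zigBarGen n)
zigBarGen-noChains n x y z t₁ t₂ = true≢false (proj₂ (zigBarGen-parity n x y t₁)) (proj₁ (zigBarGen-parity n y z t₂))

act-involution : ∀ n (σ : ℕ → ℕ) (Q : Rel) → (∀ i → InRange n i → InRange n (σ i) × σ (σ i) ≡ i) →
  ∀ x y → InRange n x → InRange n y → act n σ Q x y ≡ Q (σ x) (σ y)
act-involution n σ Q σ-inv x y rx ry = T-ext to from
  where
    to : T (act n σ Q x y) → T (Q (σ x) (σ y))
    to t with any-range⁻ _ n t
    ... | i , ri , t₁ with any-range⁻ _ n t₁
    ... | j , rj , t₂ = subst T (cong₂ Q i≡ j≡) (T-∧ʳ {σ j ≡ᵇ y} (T-∧ʳ {σ i ≡ᵇ x} t₂))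
      where
        i≡ : i ≡ σ x
        i≡ = trans (sym (proj₂ (σ-inv i ri))) (cong σ (≡ᵇ⇒≡ (σ i) x (T-∧ˡ t₂)))
        j≡ : j ≡ σ y
        j≡ = trans (sym (proj₂ (σ-inv j rj))) (cong σ (≡ᵇ⇒≡ (σ j) y (T-∧ˡ (T-∧ʳ {σ i ≡ᵇ x} t₂))))
    from : T (Q (σ x) (σ y)) → T (act n σ Q x y)
    from t = any-range⁺ _ n (σ x) (proj₁ (σ-inv x rx)) (any-range⁺ _ n (σ y) (proj₁ (σ-inv y ry))
      (T-∧⁺ {σ (σ x) ≡ᵇ x} (≡⇒≡ᵇ _ _ (proj₂ (σ-inv x rx))) (T-∧⁺ {σ (σ y) ≡ᵇ y} (≡⇒≡ᵇ _ _ (proj₂ (σ-inv y ry))) t)))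

εZ≡zigGen : ∀ n x y → InRange n x → InRange n y → act n (ε n) (Z n) x y ≡ zigGen n (ε n x) (ε n y)
εZ≡zigGen n x y rx ry =
  trans (act-involution n (ε n) (Z n) (ε-involution n) x y rx ry) (generated-noChains n (zigGen n) (zigGen-noChains n) _ _)

oZ̄≡zigBarGen : ∀ n x y → InRange n x → InRange n y → act n (o n) (Zbar n) x y ≡ zigBarGen n (o n x) (o n y)
oZ̄≡zigBarGen n x y rx ry =
  trans (act-involution n (o n) (Zbar n) (o-involution n) x y rx ry) (generated-noChains n (zigBarGen n) (zigBarGen-noChains n) _ _)

odd-∸ : ∀ m x → x ≤ m → odd (m ∸ x) ≡ (if odd x then not (odd m) else odd m)
odd-∸ m       zero    _        = refl
odd-∸ (suc m) (suc x) (s≤s x≤m) rewrite odd-∸ m x x≤m | odd-suc x | odd-suc m with odd x | odd m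
... | true  | true  = refl
... | true  | false = refl
... | false | true  = refl
... | false | false = refl

odd-complement-even : ∀ n z → odd n ≡ false → z ≤ n → odd (complement n z) ≡ not (odd z)
odd-complement-even n z e z≤ rewrite odd-∸ (suc n) z (≤-trans z≤ (n≤1+n n)) | odd-suc n | e with odd z
... | true  = refl
... | false = refl

odd-complement-odd : ∀ n z → odd n ≡ true → z ≤ n → odd (complement n z) ≡ odd z
odd-complement-odd n z e z≤ rewrite odd-∸ (suc n) z (≤-trans z≤ (n≤1+n n)) | odd-suc n | e with odd z
... | true  = refl
... | false = refl

complement-≡ᵇ-suc : ∀ n x y → InRange n x → InRange n y → (complement n y ≡ᵇ suc (complement n x)) ≡ (x ≡ᵇ suc y)
complement-≡ᵇ-suc n x y (_ , x≤n) (_ , y≤n) = T-ext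
  (λ t → ≡⇒≡ᵇ x (suc y) (sym (+-cancelˡ-≡ (complement n x) (suc y) x (begin
      complement n x + suc y     ≡⟨ +-suc (complement n x) y ⟩
      suc (complement n x) + y   ≡⟨ cong (_+ y) (≡ᵇ⇒≡ (complement n y) (suc (complement n x)) t) ⟨
      complement n y + y         ≡⟨ complement-+ y y≤n ⟩
      suc n                      ≡⟨ complement-+ x x≤n ⟨
      complement n x + x         ∎))))
  (λ t → ≡⇒≡ᵇ (complement n y) (suc (complement n x)) (+-cancelʳ-≡ y (complement n y) (suc (complement n x)) (begin
      complement n y + y         ≡⟨ complement-+ y y≤n ⟩
      suc n                      ≡⟨ complement-+ x x≤n ⟨
      complement n x + x         ≡⟨ cong (complement n x +_) (≡ᵇ⇒≡ x (suc y) t) ⟩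
      complement n x + suc y     ≡⟨ +-suc (complement n x) y ⟩
      suc (complement n x) + y   ∎)))
  where
    open ≡-Reasoning
    complement-+ : ∀ z → z ≤ n → complement n z + z ≡ suc n
    complement-+ z z≤ = m∸n+n≡m (≤-trans z≤ (n≤1+n n))

≡ᵇ-∧-cong : ∀ x y (f g : Bool) → (x ≡ suc y → f ≡ g) → ((x ≡ᵇ suc y) ∧ f) ≡ ((x ≡ᵇ suc y) ∧ g)
≡ᵇ-∧-cong x y f g h with x ≡ᵇ suc y in e
... | false = refl
... | true  = h (≡ᵇ⇒≡ x (suc y) (≡true⇒T e))

zigBarGen-complement-even : ∀ n → odd n ≡ false → ∀ x y → InRange n x → InRange n y →
  zigBarGen n x y ≡ zigGen n (complement n x) (complement n y)
zigBarGen-complement-even n even-n x y rx ry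
  rewrite inRange-true n x rx | inRange-true n y ry
        | inRange-true n (complement n x) (complement-inRange n x rx) | inRange-true n (complement n y) (complement-inRange n y ry)
        | isOdd≡odd y | isEven≡not-odd x | isOdd≡odd (complement n x) | isEven≡not-odd (complement n y)
        | complement-≡ᵇ-suc n x y rx ry | complement-≡ᵇ-suc n y x ry rx
        | odd-complement-even n x even-n (proj₂ rx) | odd-complement-even n y even-n (proj₂ ry) =
  cong₂ _∨_ (≡ᵇ-∧-cong x y _ _ (λ { refl → trans (sym (not-involutive (odd y))) (cong not (sym (odd-suc y))) }))
            (≡ᵇ-∧-cong y x _ _ (λ { refl → trans (sym (odd-suc x)) (sym (not-involutive (odd (suc x)))) }))

zigBarGen-complement-odd : ∀ n → odd n ≡ true → ∀ x y → InRange n x → InRange n y →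
  zigBarGen n x y ≡ zigGen n (complement n y) (complement n x)
zigBarGen-complement-odd n odd-n x y rx ry
  rewrite inRange-true n x rx | inRange-true n y ry
        | inRange-true n (complement n x) (complement-inRange n x rx) | inRange-true n (complement n y) (complement-inRange n y ry)
        | isOdd≡odd y | isEven≡not-odd x | isOdd≡odd (complement n y) | isEven≡not-odd (complement n x)
        | complement-≡ᵇ-suc n x y rx ry | complement-≡ᵇ-suc n y x ry rx
        | odd-complement-odd n x odd-n (proj₂ rx) | odd-complement-odd n y odd-n (proj₂ ry) =
  trans (cong₂ _∨_ (≡ᵇ-∧-cong x y (odd y) (not (odd x)) (λ { refl → trans (sym (not-involutive (odd y))) (cong not (sym (odd-suc y))) }))
                   (≡ᵇ-∧-cong y x (not (odd x)) (odd y) (λ { refl → sym (odd-suc x) })))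
        (∨-comm ((x ≡ᵇ suc y) ∧ not (odd x)) ((y ≡ᵇ suc x) ∧ odd y))

≤-complement : ∀ n x t → x + t ≤ suc n → t ≤ complement n x
≤-complement n x t x+t≤ = subst (_≤ complement n x) (m+n∸m≡n x t) (∸-monoˡ-≤ x x+t≤)

ε-complement-odd : ∀ n → odd n ≡ true → ∀ x → InRange n x → ε n (complement n x) ≡ complement n (o n x)
ε-complement-odd n odd-n x (1≤x , x≤n) with odd-dichotomy x
... | inj₁ odd-x with suc x ≤? n
...   | yes x<n rewrite o-odd n x odd-x x<n =
        trans (ε-odd n (complement n x) (trans (odd-complement-odd n x odd-n x≤n) odd-x)
                     (≤-complement n x 3 (subst (_≤ suc n) (+-comm 3 x) (s≤s x+1<n)))
                     (proj₂ (complement-inRange n x (1≤x , x≤n))))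
              (trans (∸-+-assoc (suc n) x 1) (cong (suc n ∸_) (+-comm x 1)))
  where
    x+1<n : suc (suc x) ≤ n
    x+1<n with m≤n⇒m<n∨m≡n x<n
    ... | inj₁ lt = lt
    ... | inj₂ e  = ⊥-elim (true≢false (trans (cong odd e) odd-n) (odd-suc-flip x odd-x))
...   | no x≮n rewrite o-odd-last n x odd-x x≮n with ≤-antisym x≤n (≮⇒≥ x≮n)
...     | refl = trans (cong (ε n) (m+n∸n≡m 1 n)) (sym (m+n∸n≡m 1 n))
ε-complement-odd n odd-n x (1≤x , x≤n) | inj₂ even-x rewrite o-even n x even-x (even⇒2≤ x even-x 1≤x) x≤n =
  trans (ε-even n (complement n x) (trans (odd-complement-odd n x odd-n x≤n) even-x)
                (≤-complement n x 2 (subst (_≤ suc n) (+-comm 2 x) (s≤s x<n)))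
                c+1≤n)
        (complement-pred x (even⇒2≤ x even-x 1≤x) x≤n)
  where
    x<n : suc x ≤ n
    x<n with m≤n⇒m<n∨m≡n x≤n
    ... | inj₁ lt = lt
    ... | inj₂ e  = ⊥-elim (true≢false (trans (cong odd e) odd-n) even-x)
    c+1≤n : suc (complement n x) ≤ n
    c+1≤n = subst (_≤ n) (+-∸-assoc 1 (≤-trans x≤n (n≤1+n n))) (∸-monoʳ-≤ (suc (suc n)) (even⇒2≤ x even-x 1≤x))
    complement-pred : ∀ z → 2 ≤ z → z ≤ n → suc (complement n z) ≡ complement n (z ∸ 1)
    complement-pred (suc z) _ z<n = sym (+-∸-assoc 1 (≤-trans (n≤1+n z) z<n))

-- Z_n relabelled by a word d: the label i plays the role of the element d_i of Z_n.
relabelZ : ℕ → List ℕ → Rel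
relabelZ n d x y = zigGen n (nth d x) (nth d y)

zigGen⇒consecutive : ∀ n x y → T (zigGen n x y) → Consecutive x y
zigGen⇒consecutive n x y t with T-∨⁻ {(y ≡ᵇ suc x) ∧ isOdd x} (T-∧ʳ {inRange n y} (T-∧ʳ {inRange n x} t))
... | inj₁ up   = inj₁ (≡ᵇ⇒≡ y (suc x) (T-∧ˡ up))
... | inj₂ down = inj₂ (≡ᵇ⇒≡ x (suc y) (T-∧ˡ down))

data Step : List ℕ → List ℕ → Set where
  swap-head : ∀ {x y l} → ¬ Consecutive x y → Step (x ∷ y ∷ l) (y ∷ x ∷ l)
  step-∷    : ∀ {x l l′} → Step l l′ → Step (x ∷ l) (x ∷ l′)

Step⇒swapAt : ∀ {d d′} → Step d d′ →
  ∃ λ a → 1 ≤ a × suc a ≤ length d × d′ ≡ swapAt a d × ¬ Consecutive (nth d a) (nth d (suc a))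
Step⇒swapAt (swap-head h) = 1 , s≤s z≤n , s≤s (s≤s z≤n) , refl , h
Step⇒swapAt (step-∷ s) with Step⇒swapAt s
... | suc a , _ , a<l , refl , h = suc (suc a) , s≤s z≤n , s≤s a<l , refl , h

Step-length : ∀ {d d′} → Step d d′ → length d′ ≡ length d
Step-length (swap-head _) = refl
Step-length (step-∷ s)    = cong suc (Step-length s)

sameCounts-Step : ∀ n {d d′} → Step d d′ → length d ≡ n → SameCounts n (relabelZ n d) (relabelZ n d′)
sameCounts-Step n {d} s len with Step⇒swapAt s
... | a , 1≤a , a<l , refl , h = sameCounts-trans
        (sameCounts-sym (sameCounts-relabel (relabelZ n d) 1≤a a<n
          (¬T⇒≡false (h ∘ zigGen⇒consecutive n _ _))
          (¬T⇒≡false (h ∘ ⊎-swap ∘ zigGen⇒consecutive n _ _))))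
        (sameCounts-cong n _ _ (λ i j _ _ → sym (cong₂ (zigGen n) (nth-swapAt a d i 1≤a a<l) (nth-swapAt a d j 1≤a a<l))))
  where
    a<n : suc a ≤ n
    a<n = subst (suc a ≤_) len a<l

sameCounts-Steps : ∀ n {d d′} → Star Step d d′ → length d ≡ n → SameCounts n (relabelZ n d) (relabelZ n d′)
sameCounts-Steps n ◅-refl       _   = sameCounts-refl
sameCounts-Steps n (s ◅ steps) len = sameCounts-trans (sameCounts-Step n s len) (sameCounts-Steps n steps (trans (Step-length s) len))

Steps-∷ : ∀ x {l l′} → Star Step l l′ → Star Step (x ∷ l) (x ∷ l′)
Steps-∷ x = gmap (x ∷_) step-∷

Steps-++ : ∀ {l l′} post → Star Step l l′ → Star Step (l ++ post) (l′ ++ post)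
Steps-++ post = gmap (_++ post) step-++
  where
    step-++ : ∀ {l l′} → Step l l′ → Step (l ++ post) (l′ ++ post)
    step-++ (swap-head h) = swap-head h
    step-++ (step-∷ s)    = step-∷ (step-++ s)

move-to-front : ∀ L v r → (∀ {x} → x ∈ L → ¬ Consecutive x v) → Star Step (L ++ v ∷ r) (v ∷ L ++ r)
move-to-front []      v r h = ◅-refl
move-to-front (x ∷ L) v r h = Steps-∷ x (move-to-front L v r (h ∘ there)) ◅◅ (swap-head (h (here refl)) ◅ ◅-refl)

-- Even n: ε and the complement of o in one-line notation

twice : ℕ → ℕ
twice zero    = zero
twice (suc k) = suc (suc (twice k))

odd-twice : ∀ k → odd (twice k) ≡ false
odd-twice zero    = refl
odd-twice (suc k) = odd-twice k

odd-suc-twice : ∀ k → odd (suc (twice k)) ≡ true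
odd-suc-twice zero    = refl
odd-suc-twice (suc k) = odd-suc-twice k

-- 1, 3, 2, 5, 4, …, 2k+1, 2k
εWordInit : ℕ → List ℕ
εWordInit zero    = 1 ∷ []
εWordInit (suc k) = εWordInit k ++ (suc (twice (suc k)) ∷ twice (suc k) ∷ [])

εWord : ℕ → List ℕ
εWord k = εWordInit k ++ [ twice (suc k) ]

-- 2k+1, 2k+2, 2k−1, 2k, …, 1, 2
oWord : ℕ → List ℕ
oWord zero    = 1 ∷ 2 ∷ []
oWord (suc k) = suc (twice (suc k)) ∷ twice (suc (suc k)) ∷ oWord k

length-εWordInit : ∀ k → length (εWordInit k) ≡ suc (twice k)
length-εWordInit zero    = refl
length-εWordInit (suc k) = trans (length-++ (εWordInit k)) (trans (cong (_+ 2) (length-εWordInit k)) (+-comm _ 2))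

length-εWord : ∀ k → length (εWord k) ≡ twice (suc k)
length-εWord k = trans (length-++ (εWordInit k)) (trans (cong (_+ 1) (length-εWordInit k)) (+-comm _ 1))

ε-suc-suc : ∀ n i → suc i ≤ n → ε (suc (suc n)) i ≡ ε n i
ε-suc-suc n i i<n rewrite ≤⇒≤ᵇ-true i<n | ≤⇒≤ᵇ-true (≤-trans i<n (≤-trans (n≤1+n n) (n≤1+n (suc n))))
  | ≤⇒≤ᵇ-true (≤-trans (n≤1+n i) i<n) | ≤⇒≤ᵇ-true (≤-trans (≤-trans (n≤1+n i) i<n) (≤-trans (n≤1+n n) (n≤1+n (suc n)))) = refl

εWord-suc : ∀ k → εWord (suc k) ≡ εWordInit k ++ suc (twice (suc k)) ∷ twice (suc k) ∷ [ twice (suc (suc k)) ]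
εWord-suc k = ++-assoc (εWordInit k) (suc (twice (suc k)) ∷ twice (suc k) ∷ []) [ twice (suc (suc k)) ]

nth-εWord : ∀ k i → InRange (twice (suc k)) i → nth (εWord k) i ≡ ε (twice (suc k)) i
nth-εWord zero    (suc zero)          _ = refl
nth-εWord zero    (suc (suc zero))    _ = refl
nth-εWord zero    (suc (suc (suc i))) (_ , s≤s (s≤s ()))
nth-εWord (suc k) i (1≤i , i≤N′) = trans (cong (λ w → nth w i) (εWord-suc k)) (split (i ≤? suc (twice k)))
  where
    N N′ : ℕ
    N  = twice (suc k)
    N′ = twice (suc (suc k))
    tail : List ℕ
    tail = suc N ∷ N ∷ N′ ∷ []
    -- d is i − (2k + 1), the position of i within tail
    in-tail : ∀ d → d + suc (twice k) ≡ i → ¬ i ≤ suc (twice k) → nth tail d ≡ ε N′ i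
    in-tail zero                      refl i≰ = ⊥-elim (i≰ ≤-refl)
    in-tail (suc zero)                refl _  = sym (ε-even N′ N (odd-twice (suc k)) (s≤s (s≤s z≤n)) (n≤1+n _))
    in-tail (suc (suc zero))          refl _  = sym (ε-odd N′ (suc N) (odd-suc-twice (suc k)) (s≤s (s≤s (s≤s z≤n))) (n≤1+n _))
    in-tail (suc (suc (suc zero)))    refl _  = sym (ε-even-last N′ N′ (odd-twice (suc (suc k))) (<-irrefl refl))
    in-tail (suc (suc (suc (suc d)))) refl _  = ⊥-elim (<-irrefl refl (≤-trans (s≤s (s≤s (s≤s (s≤s (s≤s (m≤n+m (twice k) d))))))
      (subst (_≤ N′) (cong (λ z → suc (suc (suc (suc z)))) (+-suc d (twice k))) i≤N′)))
    split : Dec (i ≤ suc (twice k)) → nth (εWordInit k ++ tail) i ≡ ε N′ i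
    split (yes i≤) = begin
        nth (εWordInit k ++ tail) i  ≡⟨ nth-++ˡ (εWordInit k) _ i 1≤i i≤init ⟩
        nth (εWordInit k) i          ≡⟨ nth-++ˡ (εWordInit k) [ N ] i 1≤i i≤init ⟨
        nth (εWord k) i              ≡⟨ nth-εWord k i (1≤i , ≤-trans i≤ (n≤1+n _)) ⟩
        ε N i                        ≡⟨ ε-suc-suc N i (s≤s i≤) ⟨
        ε N′ i                       ∎
      where
        open ≡-Reasoning
        i≤init : i ≤ length (εWordInit k)
        i≤init = subst (i ≤_) (sym (length-εWordInit k)) i≤
    split (no i≰) = begin
        nth (εWordInit k ++ tail) i            ≡⟨ nth-++ʳ (εWordInit k) _ i (subst (_< i) (sym (length-εWordInit k)) (≰⇒> i≰)) ⟩
        nth tail (i ∸ length (εWordInit k))    ≡⟨ cong (λ l → nth tail (i ∸ l)) (length-εWordInit k) ⟩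
        nth tail (i ∸ suc (twice k))           ≡⟨ in-tail _ (trans (+-comm _ (suc (twice k))) (m+[n∸m]≡n (≤-trans (n≤1+n _) (≰⇒> i≰)))) i≰ ⟩
        ε N′ i                                 ∎
      where open ≡-Reasoning

o-suc-suc : ∀ n j → InRange n j → o (suc (suc n)) (suc (suc j)) ≡ suc (suc (o n j))
o-suc-suc n j (1≤j , j≤n) with odd-dichotomy j
... | inj₁ odd-j with suc j ≤? n
...   | yes j<n rewrite o-odd n j odd-j j<n | o-odd (suc (suc n)) (suc (suc j)) odd-j (s≤s (s≤s j<n)) = refl
...   | no j≮n rewrite o-odd-last n j odd-j j≮n | o-odd-last (suc (suc n)) (suc (suc j)) odd-j (j≮n ∘ ≤-pred ∘ ≤-pred) = refl
o-suc-suc n j (1≤j , j≤n) | inj₂ even-j rewrite o-even n j even-j (even⇒2≤ j even-j 1≤j) j≤n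
  | o-even (suc (suc n)) (suc (suc j)) even-j (s≤s (s≤s z≤n)) (s≤s (s≤s j≤n)) with j | 1≤j
... | suc _ | _ = refl

nth-oWord : ∀ k i → InRange (twice (suc k)) i → nth (oWord k) i ≡ complement (twice (suc k)) (o (twice (suc k)) i)
nth-oWord zero    (suc zero)          _ = refl
nth-oWord zero    (suc (suc zero))    _ = refl
nth-oWord zero    (suc (suc (suc i))) (_ , s≤s (s≤s ()))
nth-oWord (suc k) (suc zero)          _ rewrite o-odd (twice (suc (suc k))) 1 refl (s≤s (s≤s z≤n)) = refl
nth-oWord (suc k) (suc (suc zero))    _ rewrite o-even (twice (suc (suc k))) 2 refl (s≤s (s≤s z≤n)) (s≤s (s≤s z≤n)) = refl
nth-oWord (suc k) (suc (suc (suc j))) (_ , s≤s (s≤s j<)) rewrite o-suc-suc (twice (suc k)) (suc j) (s≤s z≤n , j<) =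
  nth-oWord k (suc j) (s≤s z≤n , j<)

≤⇒¬consecutive-suc-suc : ∀ N x → x ≤ N → ¬ Consecutive x (suc (suc N))
≤⇒¬consecutive-suc-suc N x x≤N (inj₁ e) = <-irrefl (sym (suc-injective e)) (s≤s x≤N)
≤⇒¬consecutive-suc-suc N x x≤N (inj₂ refl) = <-irrefl refl (≤-trans (s≤s (≤-trans (n≤1+n N) (n≤1+n _))) x≤N)

∈-εWordInit-≤ : ∀ k {x} → x ∈ εWordInit k → x ≤ suc (twice k)
∈-εWordInit-≤ zero    (here refl) = ≤-refl
∈-εWordInit-≤ (suc k) x∈ with ∈-++⁻ (εWordInit k) x∈
... | inj₁ x∈′                 = ≤-trans (∈-εWordInit-≤ k x∈′) (≤-trans (n≤1+n _) (n≤1+n _))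
... | inj₂ (here refl)         = ≤-refl
... | inj₂ (there (here refl)) = n≤1+n _

∈-oWord-≤ : ∀ k {x} → x ∈ oWord k → x ≤ twice (suc k)
∈-oWord-≤ zero    (here refl)         = s≤s z≤n
∈-oWord-≤ zero    (there (here refl)) = ≤-refl
∈-oWord-≤ (suc k) (here refl)         = n≤1+n _
∈-oWord-≤ (suc k) (there (here refl)) = ≤-refl
∈-oWord-≤ (suc k) (there (there x∈))  = ≤-trans (∈-oWord-≤ k x∈) (≤-trans (n≤1+n _) (n≤1+n _))

-- Each new pair 2k+3, 2k+4 is moved to the front past smaller, non-consecutive numbers.
εWord⟶oWord : ∀ k → Star Step (εWord k) (oWord k)
εWord⟶oWord zero    = ◅-refl
εWord⟶oWord (suc k) =
  subst (λ w → Star Step w (suc N ∷ εWordInit k ++ N ∷ [ N′ ])) (sym (εWord-suc k))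
        (move-to-front (εWordInit k) (suc N) (N ∷ [ N′ ]) (λ x∈ → ≤⇒¬consecutive-suc-suc (suc (twice k)) _ (∈-εWordInit-≤ k x∈)))
  ◅◅ subst (λ w → Star Step (suc N ∷ w) (suc N ∷ oWord k ++ [ N′ ])) (++-assoc (εWordInit k) [ N ] [ N′ ])
           (Steps-∷ (suc N) (Steps-++ [ N′ ] (εWord⟶oWord k)))
  ◅◅ Steps-∷ (suc N) (subst (Star Step (oWord k ++ [ N′ ])) (cong (N′ ∷_) (++-identityʳ (oWord k)))
                          (move-to-front (oWord k) N′ [] (λ x∈ → ≤⇒¬consecutive-suc-suc N _ (∈-oWord-≤ k x∈))))
  where
    N N′ : ℕ
    N  = twice (suc k)
    N′ = twice (suc (suc k))

even⇒twice-suc : ∀ n → odd n ≡ false → 1 ≤ n → ∃ λ k → n ≡ twice (suc k)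
even⇒twice-suc (suc zero)          ()
even⇒twice-suc (suc (suc zero))    _      _ = 0 , refl
even⇒twice-suc (suc (suc (suc n))) even-n _ with even⇒twice-suc (suc n) even-n (s≤s z≤n)
... | k , refl = suc k , refl

sameCounts-even : ∀ k → let n = twice (suc k) in SameCounts n (act n (ε n) (Z n)) (act n (o n) (Zbar n))
sameCounts-even k = sameCounts-trans (sameCounts-cong n _ _ εZ≡relabelZ)
  (sameCounts-trans (sameCounts-Steps n (εWord⟶oWord k) (length-εWord k)) (sameCounts-cong n _ _ relabelZ≡oZ̄))
  where
    n : ℕ
    n = twice (suc k)
    εZ≡relabelZ : ∀ x y → InRange n x → InRange n y → act n (ε n) (Z n) x y ≡ relabelZ n (εWord k) x y
    εZ≡relabelZ x y rx ry = trans (εZ≡zigGen n x y rx ry) (sym (cong₂ (zigGen n) (nth-εWord k x rx) (nth-εWord k y ry)))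
    relabelZ≡oZ̄ : ∀ x y → InRange n x → InRange n y → relabelZ n (oWord k) x y ≡ act n (o n) (Zbar n) x y
    relabelZ≡oZ̄ x y rx ry = begin
      zigGen n (nth (oWord k) x) (nth (oWord k) y)
        ≡⟨ cong₂ (zigGen n) (nth-oWord k x rx) (nth-oWord k y ry) ⟩
      zigGen n (complement n (o n x)) (complement n (o n y))
        ≡⟨ zigBarGen-complement-even n (odd-twice (suc k)) (o n x) (o n y)
             (proj₁ (o-involution n x rx)) (proj₁ (o-involution n y ry)) ⟨
      zigBarGen n (o n x) (o n y)
        ≡⟨ oZ̄≡zigBarGen n x y rx ry ⟨
      act n (o n) (Zbar n) x y ∎
      where open ≡-Reasoning

sameCounts-odd : ∀ n → odd n ≡ true → SameCounts n (act n (ε n) (Z n)) (act n (o n) (Zbar n))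
sameCounts-odd n odd-n = sameCounts-trans (sameCounts-sym (sameCounts-complementDual n (act n (ε n) (Z n))))
                                          (sameCounts-cong n _ _ dual≡oZ̄)
  where
    dual≡oZ̄ : ∀ x y → InRange n x → InRange n y → complementDual n (act n (ε n) (Z n)) x y ≡ act n (o n) (Zbar n) x y
    dual≡oZ̄ x y rx ry = begin
      act n (ε n) (Z n) (complement n y) (complement n x)
        ≡⟨ εZ≡zigGen n _ _ (complement-inRange n y ry) (complement-inRange n x rx) ⟩
      zigGen n (ε n (complement n y)) (ε n (complement n x))
        ≡⟨ cong₂ (zigGen n) (ε-complement-odd n odd-n y ry) (ε-complement-odd n odd-n x rx) ⟩
      zigGen n (complement n (o n y)) (complement n (o n x))
        ≡⟨ zigBarGen-complement-odd n odd-n (o n x) (o n y) (proj₁ (o-involution n x rx)) (proj₁ (o-involution n y ry)) ⟨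
      zigBarGen n (o n x) (o n y)
        ≡⟨ oZ̄≡zigBarGen n x y rx ry ⟨
      act n (o n) (Zbar n) x y ∎
      where open ≡-Reasoning

theorem2p4 : ∀ (n : ℕ) → 1 ≤ n →
    (∀ (m : ℕ) → 1 ≤ m →
       Ω n (act n (ε n) (Z n)) m ≡ Ω n (act n (o n) (Zbar n)) m)
    × (∀ (k : ℕ) →
       AP-coeff n (act n (ε n) (Z n)) k ≡ AP-coeff n (act n (o n) (Zbar n)) k)
theorem2p4 n 1≤n = (λ m _ → SameCounts.Ω-≡ same m) , SameCounts.AP-coeff-≡ same
  where
    same : SameCounts n (act n (ε n) (Z n)) (act n (o n) (Zbar n))
    same with odd-dichotomy n
    ... | inj₁ odd-n  = sameCounts-odd n odd-n
    ... | inj₂ even-n with even⇒twice-suc n even-n 1≤n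
    ...   | k , refl  = sameCounts-even k
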